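{- Let $q$ be a prime power, $n\ge 1$, and let $A$ be an $n\times n$ Dickson matrix over $\mathbb{F}_{q^n}$. For $1\le k\le n$ let $A_{k-1}=A[0,1,\dots,k-1|0,1,\dots,k-1]$ be the leading principal $k\times k$ submatrix. Then $\mathrm{rank}\,A=\max\{k:\det A_{k-1}\ne 0\}$ (with the maximum taken to be $0$ if no such $k$ exists).
   Context: A Dickson matrix is an $n\times n$ matrix $A$ with rows and columns indexed by $\mathbb{Z}_n=\{0,\dots,n-1\}$ such that $A[i|j]=a_{j-i}^{q^i}$ for some $a_0,\dots,a_{n-1}\in\mathbb{F}_{q^n}$ (indices mod $n$). $A[\alpha|\beta]$ denotes the submatrix with rows in $\alpha$ and columns in $\beta$. -}

module Defs where

open import Level using (_⊔_)
open import Algebra.Bundles using (CommutativeRing)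
open import Data.Nat as ℕ using (ℕ; zero; suc; _∸_; _≤_; NonZero)
open import Data.Nat.DivMod using (_mod_)
open import Data.Nat.Primality using (Prime)
open import Data.Fin as Fin using (Fin; toℕ; punchIn; _<_)
open import Data.Product using (Σ; _×_; ∃; ∃-syntax)
open import Data.Sum using (_⊎_)
open import Relation.Nullary using (¬_)
open import Relation.Binary.PropositionalEquality using (_≡_)

IsPrimePower : ℕ → Set
IsPrimePower q = Σ ℕ λ p → Σ ℕ λ e → Prime p × 1 ≤ e × q ≡ p ℕ.^ e

module _ {c ℓ} (R : CommutativeRing c ℓ) where
  open CommutativeRing R

  IsField : Set (c ⊔ ℓ)
  IsField = (¬ (0# ≈ 1#)) × (∀ x → ¬ (x ≈ 0#) → Σ Carrier λ y → x * y ≈ 1#)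

  HasCard : ℕ → Set (c ⊔ ℓ)
  HasCard N = Σ (Fin N → Carrier) λ f →
                ((∀ i j → f i ≈ f j → i ≡ j) × (∀ x → Σ (Fin N) λ i → f i ≈ x))

  IsFiniteFieldOfOrder : ℕ → Set (c ⊔ ℓ)
  IsFiniteFieldOfOrder N = IsField × HasCard N

  pow : Carrier → ℕ → Carrier
  pow x zero    = 1#
  pow x (suc k) = x * pow x k

  sumFin : ∀ {m} → (Fin m → Carrier) → Carrier
  sumFin {zero}  f = 0#
  sumFin {suc m} f = f Fin.zero + sumFin (λ i → f (Fin.suc i))

  sign : ℕ → Carrier
  sign zero    = 1#
  sign (suc k) = - sign k

  det : ∀ {m} → (Fin m → Fin m → Carrier) → Carrier
  det {zero}  M = 1#
  det {suc m} M = sumFin λ j →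
    sign (toℕ j) * (M Fin.zero j * det (λ r s → M (Fin.suc r) (punchIn j s)))

  -- A is an n×n Dickson matrix (n = suc m) w.r.t. q:
  -- A[i|j] = a_{(j-i) mod n} ^ (q ^ i) for some a : Z_n → R
  IsDickson : ∀ (q m : ℕ) → (Fin (suc m) → Fin (suc m) → Carrier) → Set (c ⊔ ℓ)
  IsDickson q m A = Σ (Fin (suc m) → Carrier) λ a →
    ∀ i j → A i j ≈ pow (a ((suc m ℕ.+ toℕ j ∸ toℕ i) mod (suc m))) (q ℕ.^ toℕ i)

  StrictlyIncreasing : ∀ {r n} → (Fin r → Fin n) → Set
  StrictlyIncreasing f = ∀ i j → i < j → f i < f j

  HasNonsingularMinor : ∀ {n} → (Fin n → Fin n → Carrier) → ℕ → Set ℓ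
  HasNonsingularMinor {n} A r = Σ (Fin r → Fin n) λ α → Σ (Fin r → Fin n) λ β →
    StrictlyIncreasing α × StrictlyIncreasing β × ¬ (det (λ i j → A (α i) (β j)) ≈ 0#)

  -- rank A = r  (determinantal rank: largest size of a nonsingular square submatrix)
  IsRank : ∀ {n} → (Fin n → Fin n → Carrier) → ℕ → Set ℓ
  IsRank A r = HasNonsingularMinor A r × (∀ s → HasNonsingularMinor A s → s ≤ r)

  leading : ∀ {n} → (Fin n → Fin n → Carrier) → (k : ℕ) → k ≤ n → Fin k → Fin k → Carrier
  leading A k k≤n i j = A (Fin.inject≤ i k≤n) (Fin.inject≤ j k≤n)

  LeadingNonzero : ∀ {n} → (Fin n → Fin n → Carrier) → ℕ → Set ℓ
  LeadingNonzero {n} A k = Σ (1 ≤ k) λ _ → Σ (k ≤ n) λ k≤n → ¬ (det (leading A k k≤n) ≈ 0#)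

  IsMaxLeading : ∀ {n} → (Fin n → Fin n → Carrier) → ℕ → Set ℓ
  IsMaxLeading A r = (r ≡ 0 ⊎ LeadingNonzero A r) × (∀ k → LeadingNonzero A k → k ≤ r)

-- Write σ x = x ^ q. A Dickson matrix satisfies A[i+1|j] = σ (A[i|j-1]) with indices mod n, and so does
-- its transpose, because σ ^ n is the identity on F_{q^n}. Since σ is a ring endomorphism, σ and the shift
-- carry a relation expressing row t through rows 0 … t-1 to one expressing row t+1 through rows 1 … t.
-- Hence, if ρ is the first index at which the rows become dependent, rows 0 … ρ-1 span all rows; likewise
-- for the columns, with the same ρ. Every minor larger than ρ then vanishes, while the leading ρ×ρ block
-- is nonsingular: a row dependency of it would extend, through the column span, to rows 0 … ρ-1.

module Submission where

open import Defs
open import Level using (Level; _⊔_)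
open import Algebra.Bundles using (CommutativeRing)
open import Data.Nat.Base as ℕ using (ℕ; zero; suc; z≤n; s≤s; _∸_; _%_; _!)
import Data.Nat.Properties as ℕₚ
open import Data.Nat.Combinatorics using (_C_; nCk≡n!/k![n-k]!; k![n∸k]!∣n!; nCn≡1)
open import Data.Nat.Divisibility using (_∣_; _∤_; divides; ∣⇒≤; ∣1⇒≡1; m∣m*n)
open import Data.Nat.DivMod using (_mod_; m/n*n≡m; [m+n]%n≡m%n)
open import Data.Nat.Primality using (Prime; euclidsLemma; prime⇒nonTrivial; ¬prime[0])
open import Data.Fin.Base using (Fin; zero; suc; toℕ; fromℕ; fromℕ<; punchIn; punchOut; inject₁; inject≤; _<_)
import Data.Fin.Properties as Fin
open import Data.Fin.Properties
  using (_≟_; punchInᵢ≢i; punchIn-injective; punchIn-punchOut; punchOut-injective; toℕ-inject₁; toℕ-fromℕ; inject₁ℕ<)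
open import Data.Fin.Induction using (<-weakInduction; >-weakInduction)
open import Data.Fin.Permutation as Perm using (Permutation; permutation; _⟨$⟩ʳ_)
open import Data.Product.Base using (Σ; Σ-syntax; _×_; _,_; proj₁; proj₂)
open import Data.Sum.Base using (_⊎_; inj₁; inj₂)
open import Data.Vec.Functional using (updateAt; insertAt; _∷_; [])
open import Data.Vec.Functional.Properties using (updateAt-updates; updateAt-minimal; updateAt-commutes; insertAt-lookup; insertAt-punchIn)
open import Function.Base using (_∘_; const)
open import Relation.Binary.Definitions using (Decidable; tri<; tri≈; tri>)
open import Relation.Binary.PropositionalEquality as ≡ using (_≡_; _≢_)
open import Relation.Nullary.Decidable using (Dec; yes; no)
open import Relation.Nullary.Negation using (¬_; contradiction)

punchIn-inject₁-self : ∀ {k} (j : Fin k) → punchIn (inject₁ j) j ≡ suc j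
punchIn-inject₁-self zero    = ≡.refl
punchIn-inject₁-self (suc j) = ≡.cong suc (punchIn-inject₁-self j)

punchIn-suc-self : ∀ {k} (j : Fin k) → punchIn (suc j) j ≡ inject₁ j
punchIn-suc-self zero    = ≡.refl
punchIn-suc-self (suc j) = ≡.cong suc (punchIn-suc-self j)

inject₁≢suc : ∀ {n} (i : Fin n) → inject₁ i ≢ suc i
inject₁≢suc i eq = ℕₚ.<-irrefl (≡.trans (≡.sym (toℕ-inject₁ i)) (≡.cong toℕ eq)) ℕₚ.≤-refl

punchIn-inject₁≡punchIn-suc : ∀ {k} (j s : Fin k) → s ≢ j → punchIn (inject₁ j) s ≡ punchIn (suc j) s
punchIn-inject₁≡punchIn-suc zero    zero    s≢j = contradiction ≡.refl s≢j
punchIn-inject₁≡punchIn-suc zero    (suc s) _   = ≡.refl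
punchIn-inject₁≡punchIn-suc (suc j) zero    _   = ≡.refl
punchIn-inject₁≡punchIn-suc (suc j) (suc s) s≢j =
  ≡.cong suc (punchIn-inject₁≡punchIn-suc j s (s≢j ∘ ≡.cong suc))

punchIn-fromℕ : ∀ {n} (i : Fin n) → punchIn (fromℕ n) i ≡ inject₁ i
punchIn-fromℕ zero    = ≡.refl
punchIn-fromℕ (suc i) = ≡.cong suc (punchIn-fromℕ i)

punchIn-cases : ∀ {n p} {P : Fin (suc n) → Set p} (i : Fin (suc n)) →
                P i → (∀ j → P (punchIn i j)) → ∀ r → P r
punchIn-cases {P = P} i Pᵢ P-punchIn r with i ≟ r
... | yes ≡.refl = Pᵢ
... | no i≢r     = ≡.subst P (punchIn-punchOut i≢r) (P-punchIn (punchOut i≢r))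

cyclicPred : ∀ {m} → Fin (suc m) → Fin (suc m)
cyclicPred {m} zero = fromℕ m
cyclicPred (suc j)  = inject₁ j

module Determinant {c ℓ} (R : CommutativeRing c ℓ) where
  open CommutativeRing R hiding (zero)
  open import Algebra.Properties.Ring ring using (-‿involutive; -‿distribˡ-*; -‿distribʳ-*; -0#≈0#; -‿+-comm)
  open import Algebra.Properties.CommutativeSemigroup *-commutativeSemigroup using (x∙yz≈y∙xz)
  open import Algebra.Properties.Semiring.Sum semiring public
    using (sum; ∑-comm; ∑-distrib-+; sum-cong-≋; sum-remove; sum-init-last; sum-replicate-zero; *-distribˡ-sum; *-distribʳ-sum)
  open import Relation.Binary.Reasoning.Setoid setoid

  Matrix : ℕ → ℕ → Set c
  Matrix m n = Fin m → Fin n → Carrier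

  minor : ∀ {k} → Matrix (suc k) (suc k) → Fin (suc k) → Matrix k k
  minor M j r s = M (suc r) (punchIn j s)

  laplaceTerm : ∀ {k} → Matrix (suc k) (suc k) → Fin (suc k) → Carrier
  laplaceTerm M j = sign R (toℕ j) * (M zero j * det R (minor M j))

  sumFin≡sum : ∀ {m} (f : Fin m → Carrier) → sumFin R f ≡ sum f
  sumFin≡sum {zero}  f = ≡.refl
  sumFin≡sum {suc m} f = ≡.cong (f zero +_) (sumFin≡sum (f ∘ suc))

  det-laplace : ∀ {k} (M : Matrix (suc k) (suc k)) → det R M ≈ sum (laplaceTerm M)
  det-laplace M = reflexive (sumFin≡sum (laplaceTerm M))

  sum-zero : ∀ {m} (f : Fin m → Carrier) → (∀ i → f i ≈ 0#) → sum f ≈ 0#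
  sum-zero {m} f f≈0 = trans (sum-cong-≋ f≈0) (sum-replicate-zero m)

  sum-single : ∀ {m} (f : Fin m → Carrier) (i : Fin m) → (∀ j → j ≢ i → f j ≈ 0#) → sum f ≈ f i
  sum-single {suc m} f i f≈0 = begin
    sum f                          ≈⟨ sum-remove f ⟩
    f i + sum (f ∘ punchIn i)      ≈⟨ +-congˡ (sum-zero (f ∘ punchIn i) (λ j → f≈0 _ (punchInᵢ≢i i j))) ⟩
    f i + 0#                       ≈⟨ +-identityʳ _ ⟩
    f i                            ∎

  sum-pair : ∀ {m} (f : Fin m → Carrier) {i j : Fin m} → i ≢ j →
             (∀ l → l ≢ i → l ≢ j → f l ≈ 0#) → sum f ≈ f i + f j
  sum-pair {suc m} f {i} {j} i≢j f≈0 = begin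
    sum f                               ≈⟨ sum-remove f ⟩
    f i + sum (f ∘ punchIn i)           ≈⟨ +-congˡ (sum-single (f ∘ punchIn i) (punchOut i≢j) rest≈0) ⟩
    f i + f (punchIn i (punchOut i≢j))  ≡⟨ ≡.cong (λ l → f i + f l) (punchIn-punchOut i≢j) ⟩
    f i + f j                           ∎
    where
    rest≈0 : ∀ l → l ≢ punchOut i≢j → f (punchIn i l) ≈ 0#
    rest≈0 l l≢ = f≈0 _ (punchInᵢ≢i i l)
      (λ eq → l≢ (punchIn-injective i _ _ (≡.trans eq (≡.sym (punchIn-punchOut i≢j)))))

  sum-neg : ∀ {m} (f : Fin m → Carrier) → sum (λ i → - f i) ≈ - sum f
  sum-neg {zero}  f = sym -0#≈0#
  sum-neg {suc m} f = trans (+-congˡ (sum-neg (f ∘ suc))) (-‿+-comm _ _)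

  sum-combination : ∀ {m} α β (y z f : Fin m → Carrier) →
                    sum (λ r → (α * y r + - (β * z r)) * f r) ≈
                    α * sum (λ r → y r * f r) + - (β * sum (λ r → z r * f r))
  sum-combination α β y z f = begin
    sum (λ r → (α * y r + - (β * z r)) * f r)                  ≈⟨ sum-cong-≋ expand ⟩
    sum (λ r → α * (y r * f r) + - (β * (z r * f r)))
      ≈⟨ ∑-distrib-+ (λ r → α * (y r * f r)) (λ r → - (β * (z r * f r))) ⟩
    sum (λ r → α * (y r * f r)) + sum (λ r → - (β * (z r * f r)))
      ≈⟨ +-cong (*-distribˡ-sum α (λ r → y r * f r)) (sym (sum-neg (λ r → β * (z r * f r)))) ⟨
    α * sum (λ r → y r * f r) + - sum (λ r → β * (z r * f r))
      ≈⟨ +-congˡ (-‿cong (*-distribˡ-sum β (λ r → z r * f r))) ⟨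
    α * sum (λ r → y r * f r) + - (β * sum (λ r → z r * f r))  ∎
    where
    expand : ∀ r → (α * y r + - (β * z r)) * f r ≈ α * (y r * f r) + - (β * (z r * f r))
    expand r = trans (distribʳ (f r) (α * y r) (- (β * z r)))
                     (+-cong (*-assoc α (y r) (f r)) (trans (sym (-‿distribˡ-* (β * z r) (f r))) (-‿cong (*-assoc β (z r) (f r)))))

  sum-insertAt-0# : ∀ {m} (z : Fin m → Carrier) (i : Fin (suc m)) (f : Fin (suc m) → Carrier) →
                    sum (λ r → insertAt z i 0# r * f r) ≈ sum (λ u → z u * f (punchIn i u))
  sum-insertAt-0# z i f = begin
    sum (λ r → insertAt z i 0# r * f r)                                    ≈⟨ sum-remove (λ r → insertAt z i 0# r * f r) ⟩
    insertAt z i 0# i * f i + sum (λ u → insertAt z i 0# (punchIn i u) * f (punchIn i u))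
      ≈⟨ +-cong (trans (*-congʳ (reflexive (insertAt-lookup z i 0#))) (zeroˡ (f i)))
                (sum-cong-≋ (λ u → *-congʳ (reflexive (insertAt-punchIn z i 0# u)))) ⟩
    0# + sum (λ u → z u * f (punchIn i u))                                 ≈⟨ +-identityˡ _ ⟩
    sum (λ u → z u * f (punchIn i u))                                      ∎

  det-cong : ∀ {k} {M N : Matrix k k} → (∀ r s → M r s ≈ N r s) → det R M ≈ det R N
  det-cong {zero}  M≈N = refl
  det-cong {suc k} {M} {N} M≈N = begin
    det R M               ≈⟨ det-laplace M ⟩
    sum (laplaceTerm M)
      ≈⟨ sum-cong-≋ {x = laplaceTerm M} {y = laplaceTerm N}
           (λ j → *-congˡ (*-cong (M≈N _ _) (det-cong {M = minor M j} {N = minor N j} (λ r s → M≈N _ _)))) ⟩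
    sum (laplaceTerm N)   ≈⟨ det-laplace N ⟨
    det R N               ∎

  LinearInColumn : ∀ {k K} → Fin k → Matrix k k → (Fin K → Matrix k k) → (Fin K → Carrier) → Set ℓ
  LinearInColumn {k} j M Ms cs = (∀ t r s → s ≢ j → Ms t r s ≈ M r s) × (∀ r → M r j ≈ sum (λ t → cs t * Ms t r j))

  private
    laplaceTerm-linear : ∀ {k K} j (M : Matrix (suc k) (suc k)) Ms (cs : Fin K → Carrier) →
                         LinearInColumn j M Ms cs → laplaceTerm M j ≈ sum (λ t → cs t * laplaceTerm (Ms t) j)
    laplaceTerm-linear j M Ms cs (off , on) = begin
      σ * (M zero j * D)                           ≈⟨ *-congˡ (*-congʳ (on zero)) ⟩
      σ * (sum (λ t → cs t * Ms t zero j) * D)     ≈⟨ *-congˡ (*-distribʳ-sum D (λ t → cs t * Ms t zero j)) ⟩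
      σ * sum (λ t → (cs t * Ms t zero j) * D)     ≈⟨ *-distribˡ-sum σ (λ t → (cs t * Ms t zero j) * D) ⟩
      sum (λ t → σ * ((cs t * Ms t zero j) * D))   ≈⟨ sum-cong-≋ (λ t → trans (*-congˡ (*-assoc (cs t) (Ms t zero j) D))
                                                                              (x∙yz≈y∙xz σ (cs t) (Ms t zero j * D))) ⟩
      sum (λ t → cs t * (σ * (Ms t zero j * D)))   ≈⟨ sum-cong-≋ (λ t → *-congˡ (*-congˡ (*-congˡ
                                                        (det-cong (λ r s → sym (off t _ _ (punchInᵢ≢i j s))))))) ⟩
      sum (λ t → cs t * laplaceTerm (Ms t) j)      ∎
      where
      σ D : Carrier
      σ = sign R (toℕ j)
      D = det R (minor M j)

  det-linear : ∀ {k K} (j : Fin k) (M : Matrix k k) (Ms : Fin K → Matrix k k) (cs : Fin K → Carrier) →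
               LinearInColumn j M Ms cs → det R M ≈ sum (λ t → cs t * det R (Ms t))
  det-linear {suc k} {K} j M Ms cs linear@(off , on) = begin
    det R M                                             ≈⟨ det-laplace M ⟩
    sum (laplaceTerm M)                                 ≈⟨ sum-cong-≋ term-linear ⟩
    sum (λ l → sum (λ t → cs t * laplaceTerm (Ms t) l)) ≈⟨ ∑-comm (λ l t → cs t * laplaceTerm (Ms t) l) ⟩
    sum (λ t → sum (λ l → cs t * laplaceTerm (Ms t) l)) ≈⟨ sum-cong-≋ (λ t → sym (*-distribˡ-sum (cs t) (laplaceTerm (Ms t)))) ⟩
    sum (λ t → cs t * sum (laplaceTerm (Ms t)))         ≈⟨ sum-cong-≋ (λ t → *-congˡ (sym (det-laplace (Ms t)))) ⟩
    sum (λ t → cs t * det R (Ms t))                     ∎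
    where
    term-linear : ∀ l → laplaceTerm M l ≈ sum (λ t → cs t * laplaceTerm (Ms t) l)
    term-linear l with l ≟ j
    ... | yes ≡.refl = laplaceTerm-linear l M Ms cs linear
    ... | no l≢j = begin
      σ * (M zero l * det R (minor M l))
        ≈⟨ *-congˡ (*-congˡ (det-linear j′ (minor M l) (λ t → minor (Ms t) l) cs (off′ , on′))) ⟩
      σ * (M zero l * sum (λ t → cs t * D t))                ≈⟨ trans (*-congˡ (*-distribˡ-sum (M zero l) (λ t → cs t * D t)))
                                                                      (*-distribˡ-sum σ (λ t → M zero l * (cs t * D t))) ⟩
      sum (λ t → σ * (M zero l * (cs t * D t)))              ≈⟨ sum-cong-≋ (λ t → trans (*-congˡ (x∙yz≈y∙xz (M zero l) (cs t) (D t)))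
                                                                                        (x∙yz≈y∙xz σ (cs t) (M zero l * D t))) ⟩
      sum (λ t → cs t * (σ * (M zero l * D t)))              ≈⟨ sum-cong-≋ (λ t → *-congˡ (*-congˡ (*-congʳ (sym (off t _ _ l≢j))))) ⟩
      sum (λ t → cs t * laplaceTerm (Ms t) l)                ∎
      where
      σ : Carrier
      σ = sign R (toℕ l)
      j′ : Fin k
      j′ = punchOut l≢j
      D : Fin K → Carrier
      D t = det R (minor (Ms t) l)

      off′ : ∀ t r s → s ≢ j′ → minor (Ms t) l r s ≈ minor M l r s
      off′ t r s s≢j′ = off t _ _ λ eq → s≢j′ (punchIn-injective l _ _ (≡.trans eq (≡.sym (punchIn-punchOut l≢j))))

      on′ : ∀ r → minor M l r j′ ≈ sum (λ t → cs t * minor (Ms t) l r j′)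
      on′ r rewrite punchIn-punchOut l≢j = on (suc r)

  det-zero-column : ∀ {k} (j : Fin k) (M : Matrix k k) → (∀ r → M r j ≈ 0#) → det R M ≈ 0#
  det-zero-column j M M·j≈0 = det-linear {K = 0} j M (λ ()) (λ ()) ((λ ()) , M·j≈0)

  column : ∀ {m n} → Matrix m n → Fin n → Fin m → Carrier
  column M j r = M r j

  setColumn : ∀ {m n} → Matrix m n → Fin n → (Fin m → Carrier) → Matrix m n
  setColumn M j v r = updateAt (M r) j (const (v r))

  setColumn-same : ∀ {m n} (M : Matrix m n) j v r → setColumn M j v r j ≡ v r
  setColumn-same M j v r = updateAt-updates j (M r)

  setColumn-other : ∀ {m n} (M : Matrix m n) j v r {s} → s ≢ j → setColumn M j v r s ≡ M r s
  setColumn-other M j v r {s} s≢j = updateAt-minimal s j (M r) s≢j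

  setColumn-id : ∀ {m n} (M : Matrix m n) j v → (∀ r → v r ≡ M r j) → ∀ r s → setColumn M j v r s ≡ M r s
  setColumn-id M j v v≡M·j r s with s ≟ j
  ... | yes ≡.refl = ≡.trans (setColumn-same M j v r) (v≡M·j r)
  ... | no s≢j     = setColumn-other M j v r s≢j

  setColumn-comm : ∀ {m n} (M : Matrix m n) {a b} → a ≢ b → ∀ x y r s →
                   setColumn (setColumn M a x) b y r s ≡ setColumn (setColumn M b y) a x r s
  setColumn-comm M {a} {b} a≢b x y r = updateAt-commutes b a (a≢b ∘ ≡.sym) (M r)

  det-setColumn-+ : ∀ {k} (M : Matrix k k) j (u v : Fin k → Carrier) →
                    det R (setColumn M j (λ r → u r + v r)) ≈ det R (setColumn M j u) + det R (setColumn M j v)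
  det-setColumn-+ {k} M j u v = begin
    det R (setColumn M j (λ r → u r + v r))
      ≈⟨ det-linear j _ (setColumn M j u ∷ setColumn M j v ∷ []) (const 1#) (off , on) ⟩
    1# * det R (setColumn M j u) + (1# * det R (setColumn M j v) + 0#)
      ≈⟨ +-cong (*-identityˡ _) (trans (+-identityʳ _) (*-identityˡ _)) ⟩
    det R (setColumn M j u) + det R (setColumn M j v) ∎
    where
    u+v : Fin k → Carrier
    u+v r = u r + v r

    off : ∀ t r s → s ≢ j → (setColumn M j u ∷ setColumn M j v ∷ []) t r s ≈ setColumn M j (λ r → u r + v r) r s
    off zero       r s s≢j = reflexive (≡.trans (setColumn-other M j u r s≢j) (≡.sym (setColumn-other M j u+v r s≢j)))
    off (suc zero) r s s≢j = reflexive (≡.trans (setColumn-other M j v r s≢j) (≡.sym (setColumn-other M j u+v r s≢j)))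

    on : ∀ r → setColumn M j (λ r → u r + v r) r j ≈ 1# * setColumn M j u r j + (1# * setColumn M j v r j + 0#)
    on r = trans (reflexive (setColumn-same M j u+v r))
                 (sym (trans (+-cong (*-identityˡ _) (trans (+-identityʳ _) (*-identityˡ _)))
                             (reflexive (≡.cong₂ _+_ (setColumn-same M j u r) (setColumn-same M j v r)))))

  swapColumns : ∀ {m n} → Matrix m n → Fin n → Fin n → Matrix m n
  swapColumns M a b = setColumn (setColumn M a (column M b)) b (column M a)

  swapColumns-first : ∀ {m n} (M : Matrix m n) {a b} → a ≢ b → ∀ r → swapColumns M a b r a ≡ M r b
  swapColumns-first M {a} {b} a≢b r =
    ≡.trans (setColumn-other (setColumn M a (column M b)) b (column M a) r a≢b) (setColumn-same M a (column M b) r)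

  swapColumns-other : ∀ {m n} (M : Matrix m n) {a b s} → s ≢ a → s ≢ b → ∀ r → swapColumns M a b r s ≡ M r s
  swapColumns-other M {a} {b} s≢a s≢b r =
    ≡.trans (setColumn-other (setColumn M a (column M b)) b (column M a) r s≢b) (setColumn-other M a (column M b) r s≢a)

  -- Antisymmetry from alternation: expand det with u + v in both columns a and b.
  det-swap : ∀ {k} {a b : Fin k} → a ≢ b →
             (∀ N → (∀ r → N r a ≈ N r b) → det R N ≈ 0#) →
             ∀ M → det R (swapColumns M a b) ≈ - det R M
  det-swap {k} {a} {b} a≢b alternating M = inverseʳ-unique (det R M) (det R (swapColumns M a b)) (begin
    det R M + det R (P v u)                                            ≈⟨ +-cong (+-identityˡ _) (+-identityʳ _) ⟨
    (0# + det R M) + (det R (P v u) + 0#)                              ≈⟨ +-cong (+-cong (repeated u) P-uv≈M) (+-congˡ (repeated v)) ⟨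
    (det R (P u u) + det R (P u v)) + (det R (P v u) + det R (P v v))  ≈⟨ +-cong (additiveᵇ u) (additiveᵇ v) ⟨
    det R (P u (u ⊕ v)) + det R (P v (u ⊕ v))                          ≈⟨ additiveᵃ (u ⊕ v) ⟨
    det R (P (u ⊕ v) (u ⊕ v))                                          ≈⟨ repeated (u ⊕ v) ⟩
    0#                                                                 ∎)
    where
    open import Algebra.Properties.Group +-group using (inverseʳ-unique)
    u v : Fin k → Carrier
    u = column M a
    v = column M b
    _⊕_ : (Fin k → Carrier) → (Fin k → Carrier) → Fin k → Carrier
    (x ⊕ y) r = x r + y r

    P : (Fin k → Carrier) → (Fin k → Carrier) → Matrix k k
    P x y = setColumn (setColumn M a x) b y

    repeated : ∀ x → det R (P x x) ≈ 0#
    repeated x = alternating (P x x) λ r → begin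
      P x x r a                      ≡⟨ setColumn-other (setColumn M a x) b x r a≢b ⟩
      setColumn M a x r a            ≡⟨ setColumn-same M a x r ⟩
      x r                            ≡⟨ setColumn-same (setColumn M a x) b x r ⟨
      P x x r b                      ∎

    P-uv≈M : det R (P u v) ≈ det R M
    P-uv≈M = det-cong λ r s → reflexive (≡.trans
      (setColumn-id (setColumn M a u) b v (λ r → ≡.sym (setColumn-other M a u r (a≢b ∘ ≡.sym))) r s)
      (setColumn-id M a u (λ _ → ≡.refl) r s))

    additiveᵃ : ∀ y → det R (P (u ⊕ v) y) ≈ det R (P u y) + det R (P v y)
    additiveᵃ y = begin
      det R (P (u ⊕ v) y)
        ≈⟨ det-cong (λ r s → reflexive (setColumn-comm M a≢b (u ⊕ v) y r s)) ⟩
      det R (setColumn (setColumn M b y) a (u ⊕ v))                        ≈⟨ det-setColumn-+ (setColumn M b y) a u v ⟩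
      det R (setColumn (setColumn M b y) a u) + det R (setColumn (setColumn M b y) a v)
        ≈⟨ +-cong (det-cong (λ r s → reflexive (≡.sym (setColumn-comm M a≢b u y r s))))
                  (det-cong (λ r s → reflexive (≡.sym (setColumn-comm M a≢b v y r s)))) ⟩
      det R (P u y) + det R (P v y)                                        ∎

    additiveᵇ : ∀ x → det R (P x (u ⊕ v)) ≈ det R (P x u) + det R (P x v)
    additiveᵇ x = det-setColumn-+ (setColumn M a x) b u v

  EqualColumnsVanish : ℕ → Set (c ⊔ ℓ)
  EqualColumnsVanish k = ∀ (M : Matrix k k) {a b} → a ≢ b → (∀ r → M r a ≈ M r b) → det R M ≈ 0#

  -- Only the terms for the two equal columns survive, and their minors coincide.
  det-equal-adjacent-columns : ∀ {k} → EqualColumnsVanish k →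
                               ∀ (M : Matrix (suc k) (suc k)) j →
                               (∀ r → M r (inject₁ j) ≈ M r (suc j)) → det R M ≈ 0#
  det-equal-adjacent-columns {k} vanish M j M·j≈M·j+1 = begin
    det R M                                           ≈⟨ det-laplace M ⟩
    sum (laplaceTerm M)                               ≈⟨ sum-pair (laplaceTerm M) (inject₁≢suc j) other-terms ⟩
    laplaceTerm M (inject₁ j) + laplaceTerm M (suc j) ≈⟨ +-congˡ last-term ⟩
    laplaceTerm M (inject₁ j) + - laplaceTerm M (inject₁ j) ≈⟨ -‿inverseʳ _ ⟩
    0#                                                ∎
    where
    other-terms : ∀ l → l ≢ inject₁ j → l ≢ suc j → laplaceTerm M l ≈ 0#
    other-terms l l≢j l≢j+1 = trans (*-congˡ (trans (*-congˡ minor≈0) (zeroʳ _))) (zeroʳ _)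
      where
      minor≈0 : det R (minor M l) ≈ 0#
      minor≈0 = vanish (minor M l) (λ eq → inject₁≢suc j (punchOut-injective l≢j l≢j+1 eq))
        (λ r → ≡.subst₂ (λ x y → M (suc r) x ≈ M (suc r) y)
                 (≡.sym (punchIn-punchOut l≢j)) (≡.sym (punchIn-punchOut l≢j+1)) (M·j≈M·j+1 (suc r)))

    same-minor : ∀ r s → minor M (suc j) r s ≈ minor M (inject₁ j) r s
    same-minor r s with s ≟ j
    ... | yes ≡.refl = ≡.subst₂ (λ x y → M (suc r) x ≈ M (suc r) y)
                         (≡.sym (punchIn-suc-self s)) (≡.sym (punchIn-inject₁-self s)) (M·j≈M·j+1 (suc r))
    ... | no s≢j     = reflexive (≡.cong (M (suc r)) (≡.sym (punchIn-inject₁≡punchIn-suc j s s≢j)))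

    last-term : laplaceTerm M (suc j) ≈ - laplaceTerm M (inject₁ j)
    last-term = begin
      - sign R (toℕ j) * (M zero (suc j) * det R (minor M (suc j)))
        ≈⟨ *-cong (reflexive (≡.cong (λ i → - sign R i) (≡.sym (toℕ-inject₁ j))))
                  (*-cong (sym (M·j≈M·j+1 zero)) (det-cong same-minor)) ⟩
      - sign R (toℕ (inject₁ j)) * (M zero (inject₁ j) * det R (minor M (inject₁ j)))
        ≈⟨ -‿distribˡ-* _ _ ⟨
      - laplaceTerm M (inject₁ j) ∎

  det-equal-columns-< : ∀ {k} → EqualColumnsVanish k → ∀ {a b : Fin (suc k)} → a < b →
                        ∀ (M : Matrix (suc k) (suc k)) → (∀ r → M r a ≈ M r b) → det R M ≈ 0#
  det-equal-columns-< {k} vanish {a} {b} a<b = <-weakInduction P (λ ()) step b a<b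
    where
    P : Fin (suc k) → Set (c ⊔ ℓ)
    P b = a < b → ∀ (M : Matrix (suc k) (suc k)) → (∀ r → M r a ≈ M r b) → det R M ≈ 0#

    step : ∀ j → P (inject₁ j) → P (suc j)
    step j ih a<j+1 M M·a≈M·j+1 with a ≟ inject₁ j
    ... | yes ≡.refl = det-equal-adjacent-columns vanish M j M·a≈M·j+1
    ... | no a≢j = begin
      det R M                 ≈⟨ -‿involutive _ ⟨
      - - det R M             ≈⟨ -‿cong swapped ⟨
      - det R M′              ≈⟨ -‿cong (ih a<j M′ M′·a≈M′·j) ⟩
      - 0#                    ≈⟨ -0#≈0# ⟩
      0#                      ∎
      where
      M′ : Matrix (suc k) (suc k)
      M′ = swapColumns M (inject₁ j) (suc j)

      swapped : det R M′ ≈ - det R M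
      swapped = det-swap (inject₁≢suc j) (λ N → det-equal-adjacent-columns vanish N j) M

      a<j : a < inject₁ j
      a<j = Fin.≤∧≢⇒< (≡.subst (toℕ a ℕ.≤_) (≡.sym (toℕ-inject₁ j)) (ℕ.s≤s⁻¹ a<j+1)) a≢j

      M′·a≈M′·j : ∀ r → M′ r a ≈ M′ r (inject₁ j)
      M′·a≈M′·j r = begin
        M′ r a             ≡⟨ swapColumns-other M a≢j (Fin.<⇒≢ a<j+1) r ⟩
        M r a              ≈⟨ M·a≈M·j+1 r ⟩
        M r (suc j)        ≡⟨ swapColumns-first M (inject₁≢suc j) r ⟨
        M′ r (inject₁ j)   ∎

  det-equal-columns : ∀ k → EqualColumnsVanish k
  det-equal-columns (suc k) M {a} {b} a≢b M·a≈M·b with Fin.<-cmp a b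
  ... | tri< a<b _ _ = det-equal-columns-< (det-equal-columns k) a<b M M·a≈M·b
  ... | tri≈ _ a≡b _ = contradiction a≡b a≢b
  ... | tri> _ _ b<a = det-equal-columns-< (det-equal-columns k) b<a M (λ r → sym (M·a≈M·b r))

  det-unit-first-column : ∀ {k} (M : Matrix (suc k) (suc k)) (r₀ : Fin (suc k)) →
                          (∀ r → r ≢ r₀ → M r zero ≈ 0#) →
                          det R M ≈ sign R (toℕ r₀) * (M r₀ zero * det R (λ r s → M (punchIn r₀ r) (suc s)))
  det-unit-first-column M zero M·0≈0 = begin
    det R M                                       ≈⟨ det-laplace M ⟩
    laplaceTerm M zero + sum (laplaceTerm M ∘ suc) ≈⟨ +-congˡ (sum-zero (laplaceTerm M ∘ suc) later-terms) ⟩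
    laplaceTerm M zero + 0#                       ≈⟨ +-identityʳ _ ⟩
    laplaceTerm M zero                            ∎
    where
    later-terms : ∀ j → laplaceTerm M (suc j) ≈ 0#
    later-terms j = trans (*-congˡ (trans (*-congˡ (det-zero-column (punchOut j+1≢0) (minor M (suc j)) column≈0))
                                          (zeroʳ _)))
                          (zeroʳ _)
      where
      j+1≢0 : suc j ≢ zero
      j+1≢0 ()
      column≈0 : ∀ r → minor M (suc j) r (punchOut j+1≢0) ≈ 0#
      column≈0 r rewrite punchIn-punchOut j+1≢0 = M·0≈0 (suc r) λ ()
  det-unit-first-column {suc k} M (suc r₀) M·0≈0 = begin
    det R M                                         ≈⟨ det-laplace M ⟩
    laplaceTerm M zero + sum (laplaceTerm M ∘ suc)  ≈⟨ +-cong first-term (sum-cong-≋ later-terms) ⟩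
    0# + sum (λ j → σ * (x * - laplaceTerm N j))    ≈⟨ +-identityˡ _ ⟩
    sum (λ j → σ * (x * - laplaceTerm N j))         ≈⟨ *-distribˡ-sum σ (λ j → x * - laplaceTerm N j) ⟨
    σ * sum (λ j → x * - laplaceTerm N j)           ≈⟨ *-congˡ (*-distribˡ-sum x (λ j → - laplaceTerm N j)) ⟨
    σ * (x * sum (λ j → - laplaceTerm N j))         ≈⟨ *-congˡ (*-congˡ (sum-neg (laplaceTerm N))) ⟩
    σ * (x * - sum (laplaceTerm N))                 ≈⟨ *-congˡ (*-congˡ (-‿cong (det-laplace N))) ⟨
    σ * (x * - det R N)                             ≈⟨ *-congˡ (-‿distribʳ-* x (det R N)) ⟨
    σ * - (x * det R N)                             ≈⟨ -‿distribʳ-* σ _ ⟨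
    - (σ * (x * det R N))                           ≈⟨ -‿distribˡ-* σ _ ⟩
    - σ * (x * det R N)                             ∎
    where
    σ x : Carrier
    σ = sign R (toℕ r₀)
    x = M (suc r₀) zero
    N : Matrix (suc k) (suc k)
    N r s = M (punchIn (suc r₀) r) (suc s)

    first-term : laplaceTerm M zero ≈ 0#
    first-term = trans (*-congˡ (trans (*-congʳ (M·0≈0 zero λ ())) (zeroˡ _))) (zeroʳ _)

    later-terms : ∀ j → laplaceTerm M (suc j) ≈ σ * (x * - laplaceTerm N j)
    later-terms j = begin
      - s * (m * det R (minor M (suc j)))
        ≈⟨ *-congˡ (*-congˡ (det-unit-first-column (minor M (suc j)) r₀ (λ r r≢r₀ → M·0≈0 (suc r) (r≢r₀ ∘ Fin.suc-injective)))) ⟩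
      - s * (m * (σ * (x * D)))      ≈⟨ -‿distribˡ-* s _ ⟨
      - (s * (m * (σ * (x * D))))    ≈⟨ -‿cong rearrange ⟩
      - (σ * (x * (s * (m * D))))    ≈⟨ -‿distribʳ-* σ _ ⟩
      σ * - (x * (s * (m * D)))      ≈⟨ *-congˡ (-‿distribʳ-* x _) ⟩
      σ * (x * - laplaceTerm N j)    ∎
      where
      s m D : Carrier
      s = sign R (toℕ j)
      m = M zero (suc j)
      D = det R (minor N j)
      rearrange : s * (m * (σ * (x * D))) ≈ σ * (x * (s * (m * D)))
      rearrange = begin
        s * (m * (σ * (x * D)))  ≈⟨ *-congˡ (trans (x∙yz≈y∙xz m σ (x * D)) (*-congˡ (x∙yz≈y∙xz m x D))) ⟩
        s * (σ * (x * (m * D)))  ≈⟨ trans (x∙yz≈y∙xz s σ _) (*-congˡ (x∙yz≈y∙xz s x (m * D))) ⟩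
        σ * (x * (s * (m * D)))  ∎

  private
    -- Expanding the columns of index < d one at a time leaves matrices all of whose columns are
    -- columns of U; as k < s, two of them coincide.
    det-factor-through : ∀ {s k} → k ℕ.< s → (U : Matrix s k) (V : Matrix k s) → ∀ d → d ℕ.≤ s →
                         ∀ (M : Matrix s s) → (∀ r l → toℕ l ℕ.< d → M r l ≈ sum (λ t → U r t * V t l)) →
                         (∀ l → d ℕ.≤ toℕ l → Σ[ t ∈ Fin k ] ∀ r → M r l ≈ U r t) → det R M ≈ 0#
    det-factor-through {s} k<s U V zero _ M _ pure with Fin.pigeonhole k<s (λ l → proj₁ (pure l ℕ.z≤n))
    ... | i , j , i<j , same = det-equal-columns s M (Fin.<⇒≢ i<j) λ r → begin
      M r i                              ≈⟨ proj₂ (pure i ℕ.z≤n) r ⟩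
      U r (proj₁ (pure i ℕ.z≤n))         ≡⟨ ≡.cong (U r) same ⟩
      U r (proj₁ (pure j ℕ.z≤n))         ≈⟨ proj₂ (pure j ℕ.z≤n) r ⟨
      M r j                              ∎
    det-factor-through {s} {k} k<s U V (suc d) d<s M combination pure = begin
      det R M                                 ≈⟨ det-linear l₀ M Ms (λ t → V t l₀) (off , on) ⟩
      sum (λ t → V t l₀ * det R (Ms t))       ≈⟨ sum-zero _ (λ t → trans (*-congˡ (Ms-vanish t)) (zeroʳ _)) ⟩
      0#                                      ∎
      where
      l₀ : Fin s
      l₀ = fromℕ< d<s
      toℕ-l₀ : toℕ l₀ ≡ d
      toℕ-l₀ = Fin.toℕ-fromℕ< d<s

      Ms : Fin k → Matrix s s
      Ms t = setColumn M l₀ (column U t)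

      off : ∀ t r l → l ≢ l₀ → Ms t r l ≈ M r l
      off t r l l≢l₀ = reflexive (setColumn-other M l₀ (column U t) r l≢l₀)

      on : ∀ r → M r l₀ ≈ sum (λ t → V t l₀ * Ms t r l₀)
      on r = begin
        M r l₀                          ≈⟨ combination r l₀ (≡.subst (ℕ._< suc d) (≡.sym toℕ-l₀) ℕₚ.≤-refl) ⟩
        sum (λ t → U r t * V t l₀)      ≈⟨ sum-cong-≋ (λ t → trans (*-comm (U r t) (V t l₀))
                                             (*-congˡ (reflexive (≡.sym (setColumn-same M l₀ (column U t) r))))) ⟩
        sum (λ t → V t l₀ * Ms t r l₀)  ∎

      Ms-vanish : ∀ t → det R (Ms t) ≈ 0#
      Ms-vanish t = det-factor-through k<s U V d (ℕₚ.<⇒≤ d<s) (Ms t) combination′ pure′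
        where
        combination′ : ∀ r l → toℕ l ℕ.< d → Ms t r l ≈ sum (λ t′ → U r t′ * V t′ l)
        combination′ r l l<d = trans (off t r l λ l≡l₀ → ℕₚ.<-irrefl (≡.trans (≡.cong toℕ l≡l₀) toℕ-l₀) l<d)
                                     (combination r l (ℕₚ.m<n⇒m<1+n l<d))
        pure′ : ∀ l → d ℕ.≤ toℕ l → Σ[ t′ ∈ Fin k ] ∀ r → Ms t r l ≈ U r t′
        pure′ l d≤l with l ≟ l₀
        ... | yes ≡.refl = t , λ r → reflexive (setColumn-same M l₀ (column U t) r)
        ... | no l≢l₀ = proj₁ earlier , λ r → trans (off t r l l≢l₀) (proj₂ earlier r)
          where
          earlier : Σ[ t′ ∈ Fin k ] ∀ r → M r l ≈ U r t′
          earlier = pure l (ℕₚ.≤∧≢⇒< d≤l λ d≡l → l≢l₀ (Fin.toℕ-injective (≡.trans (≡.sym d≡l) (≡.sym toℕ-l₀))))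

  det-factor : ∀ {s k} → k ℕ.< s → (M : Matrix s s) (U : Matrix s k) (V : Matrix k s) →
               (∀ r l → M r l ≈ sum (λ t → U r t * V t l)) → det R M ≈ 0#
  det-factor {s} k<s M U V M≈UV = det-factor-through k<s U V s ℕₚ.≤-refl M (λ r l _ → M≈UV r l)
    (λ l s≤l → contradiction (Fin.toℕ<n l) (ℕₚ.≤⇒≯ s≤l))

  δ : ∀ {n} → Fin n → Fin n → Carrier
  δ i j with i ≟ j
  ... | yes _ = 1#
  ... | no _  = 0#

  δ-same : ∀ {n} (i : Fin n) → δ i i ≈ 1#
  δ-same i with i ≟ i
  ... | yes _  = refl
  ... | no i≢i = contradiction ≡.refl i≢i

  δ-other : ∀ {n} {i j : Fin n} → i ≢ j → δ i j ≈ 0#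
  δ-other {i = i} {j} i≢j with i ≟ j
  ... | yes i≡j = contradiction i≡j i≢j
  ... | no _    = refl

  sum-δ : ∀ {n} (f : Fin n → Carrier) (i : Fin n) → sum (λ j → f j * δ j i) ≈ f i
  sum-δ f i = begin
    sum (λ j → f j * δ j i)  ≈⟨ sum-single (λ j → f j * δ j i) i (λ j j≢i → trans (*-congˡ (δ-other j≢i)) (zeroʳ _)) ⟩
    f i * δ i i              ≈⟨ trans (*-congˡ (δ-same i)) (*-identityʳ _) ⟩
    f i                      ∎

  cofactor : ∀ {k} → Matrix (suc k) (suc k) → Fin (suc k) → Carrier
  cofactor M r = sign R (toℕ r) * det R (λ r′ s → M (punchIn r r′) (suc s))

  det-laplace-first-column : ∀ {k} (M : Matrix (suc k) (suc k)) → det R M ≈ sum (λ r → M r zero * cofactor M r)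
  det-laplace-first-column {k} M = begin
    det R M                                         ≈⟨ det-linear zero M Ms (λ t → M t zero) (off , on) ⟩
    sum (λ t → M t zero * det R (Ms t))
      ≈⟨ sum-cong-≋ {x = λ t → M t zero * det R (Ms t)} {y = λ t → M t zero * cofactor M t} (λ t → *-congˡ (unit-column t)) ⟩
    sum (λ t → M t zero * cofactor M t)             ∎
    where
    Ms : Fin (suc k) → Matrix (suc k) (suc k)
    Ms t = setColumn M zero (δ t)

    off : ∀ t r s → s ≢ zero → Ms t r s ≈ M r s
    off t r s s≢0 = reflexive (setColumn-other M zero (δ t) r s≢0)

    on : ∀ r → M r zero ≈ sum (λ t → M t zero * Ms t r zero)
    on r = sym (trans (sum-cong-≋ {x = λ t → M t zero * Ms t r zero} {y = λ t → M t zero * δ t r}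
                                  (λ t → *-congˡ (reflexive (setColumn-same M zero (δ t) r))))
                      (sum-δ (λ t → M t zero) r))

    unit-column : ∀ t → det R (Ms t) ≈ cofactor M t
    unit-column t = begin
      det R (Ms t)
        ≈⟨ det-unit-first-column (Ms t) t (λ r r≢t → trans (reflexive (setColumn-same M zero (δ t) r)) (δ-other (r≢t ∘ ≡.sym))) ⟩
      sign R (toℕ t) * (Ms t t zero * det R (λ r s → Ms t (punchIn t r) (suc s)))
        ≈⟨ *-congˡ (*-cong (trans (reflexive (setColumn-same M zero (δ t) t)) (δ-same t))
                           (det-cong (λ r s → off t _ (suc s) λ ()))) ⟩
      sign R (toℕ t) * (1# * det R (λ r s → M (punchIn t r) (suc s)))
        ≈⟨ *-congˡ (*-identityˡ _) ⟩
      cofactor M t ∎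

  -- ∑ M r (suc u) · cofactor M r expands the determinant of M with its first column replaced by column suc u.
  cofactor-orthogonal : ∀ {k} (M : Matrix (suc k) (suc k)) u → sum (λ r → M r (suc u) * cofactor M r) ≈ 0#
  cofactor-orthogonal {k} M u = begin
    sum (λ r → M r (suc u) * cofactor M r)
      ≈⟨ sum-cong-≋ {x = λ r → M r (suc u) * cofactor M r} {y = λ r → M′ r zero * cofactor M′ r}
           (λ r → *-cong (reflexive (≡.sym (setColumn-same M zero (column M (suc u)) r))) (same-cofactor r)) ⟩
    sum (λ r → M′ r zero * cofactor M′ r)      ≈⟨ det-laplace-first-column M′ ⟨
    det R M′                                   ≈⟨ det-equal-columns _ M′ {a = zero} {b = suc u} (λ ()) equal ⟩
    0#                                         ∎
    where
    M′ : Matrix (suc k) (suc k)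
    M′ = setColumn M zero (column M (suc u))
    same-cofactor : ∀ r → cofactor M r ≈ cofactor M′ r
    same-cofactor r = *-congˡ (det-cong (λ r′ s → reflexive (≡.sym (setColumn-other M zero (column M (suc u)) (punchIn r r′) {suc s} λ ()))))
    equal : ∀ r → M′ r zero ≈ M′ r (suc u)
    equal r = reflexive (≡.trans (setColumn-same M zero (column M (suc u)) r) (≡.sym (setColumn-other M zero (column M (suc u)) r {suc u} λ ())))

  module _ {n} (A : Matrix n n) where

    topRows : ∀ t → .(t ℕ.≤ n) → Matrix t n
    topRows t t≤n s = A (inject≤ s t≤n)

    InTopRowSpan : ∀ t → .(t ℕ.≤ n) → (Fin n → Carrier) → Set (c ⊔ ℓ)
    InTopRowSpan t t≤n v = Σ[ y ∈ (Fin t → Carrier) ] ∀ j → v j ≈ sum (λ s → y s * topRows t t≤n s j)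

    span-combination : ∀ {t K} .(t≤n : t ℕ.≤ n) (cs : Fin K → Carrier) (ws : Fin K → Fin n → Carrier) →
                       (∀ u → InTopRowSpan t t≤n (ws u)) → InTopRowSpan t t≤n (λ j → sum (λ u → cs u * ws u j))
    span-combination {t} t≤n cs ws ws∈span = (λ s → sum (λ u → cs u * Y u s)) , λ j → begin
      sum (λ u → cs u * ws u j)                          ≈⟨ sum-cong-≋ (λ u → *-congˡ (proj₂ (ws∈span u) j)) ⟩
      sum (λ u → cs u * sum (λ s → Y u s * T s j))       ≈⟨ sum-cong-≋ (λ u → *-distribˡ-sum (cs u) (λ s → Y u s * T s j)) ⟩
      sum (λ u → sum (λ s → cs u * (Y u s * T s j)))     ≈⟨ ∑-comm (λ u s → cs u * (Y u s * T s j)) ⟩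
      sum (λ s → sum (λ u → cs u * (Y u s * T s j)))
        ≈⟨ sum-cong-≋ (λ s → sum-cong-≋ (λ u → sym (*-assoc (cs u) (Y u s) (T s j)))) ⟩
      sum (λ s → sum (λ u → (cs u * Y u s) * T s j))     ≈⟨ sum-cong-≋ (λ s → *-distribʳ-sum (T s j) (λ u → cs u * Y u s)) ⟨
      sum (λ s → sum (λ u → cs u * Y u s) * T s j)       ∎
      where
      T : Matrix t n
      T = topRows t t≤n
      Y : ∀ u → Fin t → Carrier
      Y u = proj₁ (ws∈span u)

    top-row-in-span : ∀ {t} .(t≤n : t ℕ.≤ n) i → toℕ i ℕ.< t → InTopRowSpan t t≤n (A i)
    top-row-in-span {t} t≤n i i<t = (λ s → δ s s₀) , λ j → begin
      A i j                                    ≡⟨ ≡.cong (λ i → A i j) inject≤-s₀≡i ⟨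
      topRows t t≤n s₀ j                        ≈⟨ sum-δ (λ s → topRows t t≤n s j) s₀ ⟨
      sum (λ s → topRows t t≤n s j * δ s s₀)    ≈⟨ sum-cong-≋ (λ s → *-comm (topRows t t≤n s j) (δ s s₀)) ⟩
      sum (λ s → δ s s₀ * topRows t t≤n s j)    ∎
      where
      s₀ : Fin t
      s₀ = fromℕ< i<t
      inject≤-s₀≡i : inject≤ s₀ t≤n ≡ i
      inject≤-s₀≡i = Fin.toℕ-injective (≡.trans (Fin.toℕ-inject≤ s₀ t≤n) (Fin.toℕ-fromℕ< i<t))

  transpose : ∀ {m n} → Matrix m n → Matrix n m
  transpose A i j = A j i

  RowsSpannedByTop : ∀ {n} → Matrix n n → ∀ t → .(t ℕ.≤ n) → Set (c ⊔ ℓ)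
  RowsSpannedByTop A t t≤n = ∀ i → InTopRowSpan A t t≤n (A i)

  minors-vanish-beyond-row-span : ∀ {n} (A : Matrix n n) {ρ} .(ρ≤n : ρ ℕ.≤ n) → RowsSpannedByTop A ρ ρ≤n →
                                  ∀ {s} (α β : Fin s → Fin n) → ρ ℕ.< s → det R (λ i u → A (α i) (β u)) ≈ 0#
  minors-vanish-beyond-row-span A ρ≤n spanned α β ρ<s =
    det-factor ρ<s _ (λ i t → proj₁ (spanned (α i)) t) (λ t u → topRows A _ ρ≤n t (β u)) (λ i u → proj₂ (spanned (α i)) (β u))

  minors-vanish-beyond-column-span : ∀ {n} (A : Matrix n n) {γ} .(γ≤n : γ ℕ.≤ n) → RowsSpannedByTop (transpose A) γ γ≤n →
                                     ∀ {s} (α β : Fin s → Fin n) → γ ℕ.< s → det R (λ i u → A (α i) (β u)) ≈ 0#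
  minors-vanish-beyond-column-span A γ≤n spanned α β γ<s =
    det-factor γ<s _ (λ i t → A (α i) (inject≤ t γ≤n)) (λ t u → proj₁ (spanned (β u)) t)
      (λ i u → trans (proj₂ (spanned (β u)) (α i)) (sum-cong-≋ (λ t → *-comm (proj₁ (spanned (β u)) t) (A (α i) (inject≤ t γ≤n)))))

  IsTwistedCirculant : (Carrier → Carrier) → ∀ {m} → Matrix (suc m) (suc m) → Set ℓ
  IsTwistedCirculant σ A = ∀ i i′ → toℕ i′ ≡ suc (toℕ i) → ∀ j → A i′ j ≈ σ (A i (cyclicPred j))

  strictly-increasing-endo≗id : ∀ {r} (β : Fin r → Fin r) → StrictlyIncreasing R β → ∀ u → β u ≡ u
  strictly-increasing-endo≗id {suc r} β β↑ u = Fin.toℕ-injective (ℕₚ.≤-antisym (β-below u) (β-above u))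
    where
    β-above : ∀ u → toℕ u ℕ.≤ toℕ (β u)
    β-above = <-weakInduction _ z≤n λ i i≤βi →
      ℕₚ.<-≤-trans (s≤s (≡.subst (ℕ._≤ toℕ (β (inject₁ i))) (Fin.toℕ-inject₁ i) i≤βi))
                   (β↑ (inject₁ i) (suc i) (Fin.≤̄⇒inject₁< ℕₚ.≤-refl))
    β-below : ∀ u → toℕ (β u) ℕ.≤ toℕ u
    β-below = >-weakInduction _ (≡.subst (toℕ (β (fromℕ r)) ℕ.≤_) (≡.sym (Fin.toℕ-fromℕ r)) (Fin.toℕ≤pred[n] (β (fromℕ r))))
      λ i βi+1≤i+1 → ≡.subst (toℕ (β (inject₁ i)) ℕ.≤_) (≡.sym (Fin.toℕ-inject₁ i))
        (ℕₚ.≤-pred (ℕₚ.<-≤-trans (β↑ (inject₁ i) (suc i) (Fin.≤̄⇒inject₁< ℕₚ.≤-refl)) βi+1≤i+1))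

module FieldProperties {c ℓ} (F : CommutativeRing c ℓ) (isField : IsField F) where
  open CommutativeRing F hiding (zero)
  open import Algebra.Properties.Ring ring using (-0#≈0#; -‿involutive; -‿distribˡ-*)
  open import Relation.Binary.Reasoning.Setoid setoid

  1≉0 : ¬ 1# ≈ 0#
  1≉0 1≈0 = proj₁ isField (sym 1≈0)

  inverse : ∀ x → ¬ x ≈ 0# → Σ[ y ∈ Carrier ] x * y ≈ 1#
  inverse = proj₂ isField

  x*y≈0⇒y≈0 : ∀ {x y} → ¬ x ≈ 0# → x * y ≈ 0# → y ≈ 0#
  x*y≈0⇒y≈0 {x} {y} x≉0 xy≈0 = begin
    y                  ≈⟨ *-identityˡ y ⟨
    1# * y             ≈⟨ *-congʳ (trans (*-comm x⁻¹ x) xx⁻¹≈1) ⟨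
    (x⁻¹ * x) * y      ≈⟨ *-assoc x⁻¹ x y ⟩
    x⁻¹ * (x * y)      ≈⟨ *-congˡ xy≈0 ⟩
    x⁻¹ * 0#           ≈⟨ zeroʳ x⁻¹ ⟩
    0#                 ∎
    where
    x⁻¹ : Carrier
    x⁻¹ = proj₁ (inverse x x≉0)
    xx⁻¹≈1 : x * x⁻¹ ≈ 1#
    xx⁻¹≈1 = proj₂ (inverse x x≉0)

  *-nonzero : ∀ {x y} → ¬ x ≈ 0# → ¬ y ≈ 0# → ¬ x * y ≈ 0#
  *-nonzero x≉0 y≉0 = y≉0 ∘ x*y≈0⇒y≈0 x≉0

  -‿nonzero : ∀ {x} → ¬ x ≈ 0# → ¬ - x ≈ 0#
  -‿nonzero {x} x≉0 -x≈0 = x≉0 (trans (sym (-‿involutive x)) (trans (-‿cong -x≈0) -0#≈0#))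

  sign-nonzero : ∀ k → ¬ sign F k ≈ 0#
  sign-nonzero zero    = 1≉0
  sign-nonzero (suc k) = -‿nonzero (sign-nonzero k)

  *-cancelʳ : ∀ {x y z} → ¬ z ≈ 0# → x * z ≈ y * z → x ≈ y
  *-cancelʳ {x} {y} {z} z≉0 xz≈yz = x∙y⁻¹≈ε⇒x≈y x y (x*y≈0⇒y≈0 z≉0 (begin
    z * (x + - y)       ≈⟨ *-comm z _ ⟩
    (x + - y) * z       ≈⟨ distribʳ z x (- y) ⟩
    x * z + - y * z     ≈⟨ +-congˡ (-‿distribˡ-* y z) ⟨
    x * z + - (y * z)   ≈⟨ x≈y⇒x∙y⁻¹≈ε xz≈yz ⟩
    0#                  ∎))
    where open import Algebra.Properties.Group +-group using (x∙y⁻¹≈ε⇒x≈y; x≈y⇒x∙y⁻¹≈ε)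

module FieldLinearAlgebra {c ℓ} (F : CommutativeRing c ℓ) (isField : IsField F)
                          (_≈?_ : Decidable (CommutativeRing._≈_ F)) where
  open CommutativeRing F hiding (zero)
  open Determinant F
  open FieldProperties F isField
  open import Algebra.Properties.Ring ring using (-‿distribˡ-*; -‿distribʳ-*; -0#≈0#; -‿involutive)
  open import Algebra.Properties.CommutativeSemigroup *-commutativeSemigroup using (x∙yz≈y∙xz)
  open import Relation.Binary.Reasoning.Setoid setoid

  Annihilates : ∀ {k K} → (Fin k → Carrier) → Matrix k K → Set ℓ
  Annihilates {k} y A = ∀ l → sum (λ r → y r * A r l) ≈ 0#

  RowDependency : ∀ {k K} → Matrix k K → Set (c ⊔ ℓ)
  RowDependency {k} A = Σ[ y ∈ (Fin k → Carrier) ] (Σ[ r ∈ Fin k ] ¬ y r ≈ 0#) × Annihilates y A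

  annihilates-punchIn : ∀ {k K} (B : Matrix (suc k) K) y u → y u ≈ 0# → Annihilates y B →
                        Annihilates (y ∘ punchIn u) (λ r → B (punchIn u r))
  annihilates-punchIn B y u yᵤ≈0 yB≈0 l = begin
    sum (λ r → y (punchIn u r) * B (punchIn u r) l)               ≈⟨ +-identityˡ _ ⟨
    0# + sum (λ r → y (punchIn u r) * B (punchIn u r) l)          ≈⟨ +-congʳ (trans (*-congʳ yᵤ≈0) (zeroˡ _)) ⟨
    y u * B u l + sum (λ r → y (punchIn u r) * B (punchIn u r) l) ≈⟨ sum-remove {i = u} (λ r → y r * B r l) ⟨
    sum (λ r → y r * B r l)                                       ≈⟨ yB≈0 l ⟩
    0#                                                            ∎

  dependent-row-in-span : ∀ {k K} (B : Matrix (suc k) K) y u → ¬ y u ≈ 0# → Annihilates y B →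
                          Σ[ z ∈ (Fin k → Carrier) ] ∀ l → B u l ≈ sum (λ r → z r * B (punchIn u r) l)
  dependent-row-in-span {k} {K} B y u yᵤ≉0 yB≈0 = (λ r → - (yᵤ⁻¹ * y (punchIn u r))) , λ l → begin
    B u l                                  ≈⟨ *-identityˡ _ ⟨
    1# * B u l                             ≈⟨ *-congʳ (trans (*-comm yᵤ⁻¹ (y u)) (proj₂ (inverse (y u) yᵤ≉0))) ⟨
    (yᵤ⁻¹ * y u) * B u l                   ≈⟨ *-assoc _ _ _ ⟩
    yᵤ⁻¹ * (y u * B u l)
      ≈⟨ *-congˡ (inverseˡ-unique _ _ (trans (sym (sum-remove {i = u} (λ r → y r * B r l))) (yB≈0 l))) ⟩
    yᵤ⁻¹ * - others l                      ≈⟨ -‿distribʳ-* yᵤ⁻¹ (others l) ⟨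
    - (yᵤ⁻¹ * others l)                    ≈⟨ -‿cong (*-distribˡ-sum yᵤ⁻¹ (λ r → y (punchIn u r) * B (punchIn u r) l)) ⟩
    - sum (λ r → yᵤ⁻¹ * (y (punchIn u r) * B (punchIn u r) l))
                                           ≈⟨ sum-neg (λ r → yᵤ⁻¹ * (y (punchIn u r) * B (punchIn u r) l)) ⟨
    sum (λ r → - (yᵤ⁻¹ * (y (punchIn u r) * B (punchIn u r) l)))
                                           ≈⟨ sum-cong-≋ (λ r → trans (-‿cong (sym (*-assoc yᵤ⁻¹ (y (punchIn u r)) (B (punchIn u r) l))))
                                                                      (-‿distribˡ-* (yᵤ⁻¹ * y (punchIn u r)) (B (punchIn u r) l))) ⟩
    sum (λ r → - (yᵤ⁻¹ * y (punchIn u r)) * B (punchIn u r) l) ∎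
    where
    open import Algebra.Properties.Group +-group using (inverseˡ-unique)
    yᵤ⁻¹ : Carrier
    yᵤ⁻¹ = proj₁ (inverse (y u) yᵤ≉0)
    others : Fin K → Carrier
    others l = sum (λ r → y (punchIn u r) * B (punchIn u r) l)

  -- The dependent row lies in the span of the other k rows, through which the columns of M then factor.
  det≈0-of-row-dependency : ∀ {k} (M : Matrix k k) → RowDependency M → det F M ≈ 0#
  det≈0-of-row-dependency {suc k} M (y , (u , yᵤ≉0) , yM≈0) = det-factor (ℕₚ.n<1+n k) M U V M≈UV
    where
    z : Fin k → Carrier
    z = proj₁ (dependent-row-in-span M y u yᵤ≉0 yM≈0)

    V : Matrix k (suc k)
    V t l = M (punchIn u t) l

    U : Matrix (suc k) k
    U r t with r Fin.≟ u
    ... | yes _ = z t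
    ... | no _  = δ r (punchIn u t)

    U-row-u : ∀ t → U u t ≡ z t
    U-row-u t with u Fin.≟ u
    ... | yes _  = ≡.refl
    ... | no u≢u = contradiction ≡.refl u≢u

    U-other-row : ∀ {r} → r ≢ u → ∀ t → U r t ≡ δ r (punchIn u t)
    U-other-row {r} r≢u t with r Fin.≟ u
    ... | yes r≡u = contradiction r≡u r≢u
    ... | no _    = ≡.refl

    M≈UV : ∀ r l → M r l ≈ sum (λ t → U r t * V t l)
    M≈UV r l = by-row (r Fin.≟ u)
      where
      by-row : Dec (r ≡ u) → M r l ≈ sum (λ t → U r t * V t l)
      by-row (yes ≡.refl) = trans (proj₂ (dependent-row-in-span M y u yᵤ≉0 yM≈0) l)
                                  (sum-cong-≋ (λ t → *-congʳ (reflexive (≡.sym (U-row-u t)))))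
      by-row (no r≢u) = sym (begin
        sum (λ t → U r t * V t l)                    ≈⟨ sum-cong-≋ (λ t → *-congʳ (reflexive (U-other-row r≢u t))) ⟩
        sum (λ t → δ r (punchIn u t) * V t l)
          ≈⟨ sum-single _ t₀ (λ t t≢t₀ → trans (*-congʳ (δ-other (r≢punchIn t t≢t₀))) (zeroˡ _)) ⟩
        δ r (punchIn u t₀) * V t₀ l                  ≡⟨ ≡.cong (λ i → δ r i * M i l) (punchIn-punchOut u≢r) ⟩
        δ r r * M r l                                ≈⟨ trans (*-congʳ (δ-same r)) (*-identityˡ _) ⟩
        M r l                                        ∎)
        where
        u≢r : u ≢ r
        u≢r = r≢u ∘ ≡.sym
        t₀ : Fin k
        t₀ = punchOut u≢r
        r≢punchIn : ∀ t → t ≢ t₀ → r ≢ punchIn u t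
        r≢punchIn t t≢t₀ r≡ = t≢t₀ (Fin.punchIn-injective u t t₀ (≡.trans (≡.sym r≡) (≡.sym (punchIn-punchOut u≢r))))

  nonsingular⇒left-null-trivial : ∀ {k} (M : Matrix k k) → ¬ det F M ≈ 0# →
                                  ∀ y → Annihilates y M → ∀ r → y r ≈ 0#
  nonsingular⇒left-null-trivial M det≉0 y yM≈0 r with y r ≈? 0#
  ... | yes yᵣ≈0 = yᵣ≈0
  ... | no yᵣ≉0  = contradiction (det≈0-of-row-dependency M (y , (r , yᵣ≉0) , yM≈0)) det≉0

  -- w = y r₀ · κ − κ r₀ · y kills N and vanishes at r₀, so it vanishes, N without row r₀ being nonsingular.
  left-null-proportional : ∀ {k} (N : Matrix (suc k) k) (r₀ : Fin (suc k)) → ¬ det F (λ r u → N (punchIn r₀ r) u) ≈ 0# →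
                           ∀ y κ → Annihilates y N → Annihilates κ N → ∀ r → y r₀ * κ r ≈ κ r₀ * y r
  left-null-proportional {k} N r₀ N′≉0 y κ yN≈0 κN≈0 r =
    trans (inverseˡ-unique _ _ (w≈0 r)) (-‿involutive _)
    where
    open import Algebra.Properties.Group +-group using (inverseˡ-unique)
    w : Fin (suc k) → Carrier
    w r = y r₀ * κ r + - (κ r₀ * y r)

    wN≈0 : Annihilates w N
    wN≈0 u = begin
      sum (λ r → w r * N r u)                                                    ≈⟨ sum-combination (y r₀) (κ r₀) κ y (λ r → N r u) ⟩
      y r₀ * sum (λ r → κ r * N r u) + - (κ r₀ * sum (λ r → y r * N r u))
        ≈⟨ +-cong (*-congˡ (κN≈0 u)) (-‿cong (*-congˡ (yN≈0 u))) ⟩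
      y r₀ * 0# + - (κ r₀ * 0#)                                                  ≈⟨ +-cong (zeroʳ _) (trans (-‿cong (zeroʳ _)) -0#≈0#) ⟩
      0# + 0#                                                                    ≈⟨ +-identityˡ 0# ⟩
      0#                                                                         ∎

    wᵣ₀≈0 : w r₀ ≈ 0#
    wᵣ₀≈0 = trans (+-congʳ (*-comm (y r₀) (κ r₀))) (-‿inverseʳ (κ r₀ * y r₀))

    w≈0 : ∀ r → w r ≈ 0#
    w≈0 = punchIn-cases r₀ wᵣ₀≈0
      (nonsingular⇒left-null-trivial _ N′≉0 (w ∘ punchIn r₀) (annihilates-punchIn N w r₀ wᵣ₀≈0 wN≈0))

  -- The cofactors κ of the first column kill the other columns, as y does, so y r₀ · κ = κ r₀ · y;
  -- and y r₀ · det M is y r₀ · κ applied to the first column, i.e. κ r₀ times y applied to it.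
  nonsingular-by-first-column : ∀ {k} (M : Matrix (suc k) (suc k)) (y : Fin (suc k) → Carrier) (r₀ : Fin (suc k)) →
    ¬ y r₀ ≈ 0# → Annihilates y (λ r u → M r (suc u)) → ¬ sum (λ r → y r * M r zero) ≈ 0# →
    ¬ det F (λ r u → M (punchIn r₀ r) (suc u)) ≈ 0# → ¬ det F M ≈ 0#
  nonsingular-by-first-column {k} M y r₀ yᵣ₀≉0 yM₊≈0 b≉0 N≉0 detM≈0 =
    *-nonzero (*-nonzero (sign-nonzero (toℕ r₀)) N≉0) b≉0 (begin
      κ r₀ * b                              ≈⟨ *-distribˡ-sum (κ r₀) (λ r → y r * M r zero) ⟩
      sum (λ r → κ r₀ * (y r * M r zero))   ≈⟨ sum-cong-≋ {x = λ r → κ r₀ * (y r * M r zero)} {y = λ r → M r zero * (y r₀ * κ r)}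
                                                 (λ r → trans (sym (*-assoc (κ r₀) (y r) (M r zero)))
                                                        (trans (*-comm _ _) (*-congˡ (sym (proportional r))))) ⟩
      sum (λ r → M r zero * (y r₀ * κ r))   ≈⟨ sum-cong-≋ {x = λ r → M r zero * (y r₀ * κ r)} {y = λ r → y r₀ * (M r zero * κ r)}
                                                 (λ r → x∙yz≈y∙xz (M r zero) (y r₀) (κ r)) ⟩
      sum (λ r → y r₀ * (M r zero * κ r))   ≈⟨ *-distribˡ-sum (y r₀) (λ r → M r zero * κ r) ⟨
      y r₀ * sum (λ r → M r zero * κ r)     ≈⟨ *-congˡ (det-laplace-first-column M) ⟨
      y r₀ * det F M                        ≈⟨ trans (*-congˡ detM≈0) (zeroʳ _) ⟩
      0#                                    ∎)
    where
    κ : Fin (suc k) → Carrier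
    κ = cofactor M
    b : Carrier
    b = sum (λ r → y r * M r zero)

    proportional : ∀ r → y r₀ * κ r ≈ κ r₀ * y r
    proportional = left-null-proportional (λ r u → M r (suc u)) r₀ N≉0 y κ yM₊≈0
      (λ u → trans (sum-cong-≋ (λ r → *-comm (κ r) (M r (suc u)))) (cofactor-orthogonal M u))

  -- z lives on the rows other than r₀; combining it with y cancels the first column.
  row-dependency-by-combination : ∀ {k K} (A : Matrix (suc k) (suc K)) (y : Fin (suc k) → Carrier) (r₀ : Fin (suc k)) →
    ¬ y r₀ ≈ 0# → Annihilates y (λ r l → A r (suc l)) →
    RowDependency (λ r l → A (punchIn r₀ r) (suc l)) → RowDependency A
  row-dependency-by-combination {k} A y r₀ yᵣ₀≉0 yA₊≈0 (z , (u₀ , zᵤ₀≉0) , zA′≈0) = by-cases (bz ≈? 0#)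
    where
    ẑ : Fin (suc k) → Carrier
    ẑ = insertAt z r₀ 0#
    bz b : Carrier
    bz = sum (λ r → ẑ r * A r zero)
    b = sum (λ r → y r * A r zero)

    ẑA₊≈0 : Annihilates ẑ (λ r l → A r (suc l))
    ẑA₊≈0 l = trans (sum-insertAt-0# z r₀ (λ r → A r (suc l))) (zA′≈0 l)

    ẑ≉0 : ¬ ẑ (punchIn r₀ u₀) ≈ 0#
    ẑ≉0 = zᵤ₀≉0 ∘ trans (reflexive (≡.sym (insertAt-punchIn z r₀ 0# u₀)))

    w : Fin (suc k) → Carrier
    w r = bz * y r + - (b * ẑ r)

    wA≈0 : Annihilates w A
    wA≈0 l = trans (sum-combination bz b y ẑ (λ r → A r l)) (by-column l)
      where
      by-column : ∀ l → bz * sum (λ r → y r * A r l) + - (b * sum (λ r → ẑ r * A r l)) ≈ 0#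
      by-column zero    = trans (+-congʳ (*-comm bz b)) (-‿inverseʳ (b * bz))
      by-column (suc l) = trans (+-cong (trans (*-congˡ (yA₊≈0 l)) (zeroʳ bz)) (-‿cong (trans (*-congˡ (ẑA₊≈0 l)) (zeroʳ b))))
                                (trans (+-identityˡ _) -0#≈0#)

    wᵣ₀≈bzyᵣ₀ : w r₀ ≈ bz * y r₀
    wᵣ₀≈bzyᵣ₀ = begin
      bz * y r₀ + - (b * ẑ r₀)   ≈⟨ +-congˡ (-‿cong (*-congˡ (reflexive (insertAt-lookup z r₀ 0#)))) ⟩
      bz * y r₀ + - (b * 0#)     ≈⟨ +-congˡ (trans (-‿cong (zeroʳ b)) -0#≈0#) ⟩
      bz * y r₀ + 0#             ≈⟨ +-identityʳ _ ⟩
      bz * y r₀                  ∎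

    by-cases : Dec (bz ≈ 0#) → RowDependency A
    by-cases (yes bz≈0) = ẑ , (punchIn r₀ u₀ , ẑ≉0) , λ { zero → bz≈0 ; (suc l) → ẑA₊≈0 l }
    by-cases (no bz≉0)  = w , (r₀ , *-nonzero bz≉0 yᵣ₀≉0 ∘ trans (sym wᵣ₀≈bzyᵣ₀)) , wA≈0

  NonsingularMinor : ∀ {k K} → Matrix k K → Set ℓ
  NonsingularMinor {k} {K} A =
    Σ[ β ∈ (Fin k → Fin K) ] StrictlyIncreasing F β × ¬ det F (λ r u → A r (β u)) ≈ 0#

  private
    suc-increasing : ∀ {k K} {β : Fin k → Fin K} → StrictlyIncreasing F β → StrictlyIncreasing F (suc ∘ β)
    suc-increasing β↑ i j i<j = ℕ.s<s (β↑ i j i<j)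

    zero∷suc-increasing : ∀ {k K} {β : Fin k → Fin K} → StrictlyIncreasing F β →
                          StrictlyIncreasing F (zero ∷ (suc ∘ β))
    zero∷suc-increasing β↑ zero    (suc j) _   = ℕ.z<s
    zero∷suc-increasing β↑ (suc i) (suc j) i<j = ℕ.s<s (β↑ i j (ℕ.s<s⁻¹ i<j))

    extend-by-first-column : ∀ {k K} (A : Matrix k (suc K)) (y : Fin k → Carrier) (r₀ : Fin k) →
      ¬ y r₀ ≈ 0# → Annihilates y (λ r l → A r (suc l)) → ¬ sum (λ r → y r * A r zero) ≈ 0# →
      (∀ {k′} (A′ : Matrix k′ K) → NonsingularMinor A′ ⊎ RowDependency A′) →
      NonsingularMinor A ⊎ RowDependency A
    extend-by-first-column {suc k} A y r₀ yᵣ₀≉0 yA₊≈0 b≉0 recurse with recurse (λ r l → A (punchIn r₀ r) (suc l))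
    ... | inj₁ (β , β↑ , minor≉0) = inj₁ (zero ∷ (suc ∘ β) , zero∷suc-increasing β↑ ,
            nonsingular-by-first-column (λ r u → A r ((zero ∷ (suc ∘ β)) u)) y r₀ yᵣ₀≉0 (yA₊≈0 ∘ β) b≉0 minor≉0)
    ... | inj₂ dependency = inj₂ (row-dependency-by-combination A y r₀ yᵣ₀≉0 yA₊≈0 dependency)

  nonsingular-minor⊎row-dependency : ∀ K {k} (A : Matrix k K) → NonsingularMinor A ⊎ RowDependency A
  nonsingular-minor⊎row-dependency zero    {zero}  A = inj₁ ((λ ()) , (λ ()) , 1≉0)
  nonsingular-minor⊎row-dependency zero    {suc k} A = inj₂ (const 1# , (zero , 1≉0) , λ ())
  nonsingular-minor⊎row-dependency (suc K) {k}     A with nonsingular-minor⊎row-dependency K (λ r l → A r (suc l))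
  ... | inj₁ (β , β↑ , minor≉0) = inj₁ (suc ∘ β , suc-increasing β↑ , minor≉0)
  ... | inj₂ (y , (r₀ , yᵣ₀≉0) , yA₊≈0) with sum (λ r → y r * A r zero) ≈? 0#
  ...   | yes b≈0 = inj₂ (y , (r₀ , yᵣ₀≉0) , λ { zero → b≈0 ; (suc l) → yA₊≈0 l })
  ...   | no b≉0  = extend-by-first-column A y r₀ yᵣ₀≉0 yA₊≈0 b≉0 (nonsingular-minor⊎row-dependency K)

  private
    inject≤-increasing : ∀ {k n} .(k≤n : k ℕ.≤ n) → StrictlyIncreasing F (λ (i : Fin k) → inject≤ i k≤n)
    inject≤-increasing k≤n i j i<j = ≡.subst₂ ℕ._<_ (≡.sym (Fin.toℕ-inject≤ i k≤n)) (≡.sym (Fin.toℕ-inject≤ j k≤n)) i<j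

  -- A row dependency of the leading block extends to the whole top rows, contradicting their nonsingular minor.
  leading-minor-nonsingular : ∀ {n ρ} (A : Matrix n n) (ρ≤n : ρ ℕ.≤ n) → NonsingularMinor (topRows A ρ ρ≤n) →
                              RowsSpannedByTop (transpose A) ρ ρ≤n → ¬ det F (leading F A ρ ρ≤n) ≈ 0#
  leading-minor-nonsingular {n} {ρ} A ρ≤n (β , _ , minor≉0) columns-spanned
    with nonsingular-minor⊎row-dependency ρ (leading F A ρ ρ≤n)
  ... | inj₁ (β′ , β′↑ , L≉0) = L≉0 ∘ trans (det-cong λ r u →
          reflexive (≡.cong (leading F A ρ ρ≤n r) (strictly-increasing-endo≗id β′ β′↑ u)))
  ... | inj₂ (y , (r₀ , yᵣ₀≉0) , yL≈0) = λ _ → yᵣ₀≉0 (nonsingular⇒left-null-trivial _ minor≉0 y (λ u → y-kills (β u)) r₀)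
    where
    y-kills : ∀ j → sum (λ r → y r * topRows A ρ ρ≤n r j) ≈ 0#
    y-kills j = begin
      sum (λ r → y r * A (inject≤ r ρ≤n) j)
        ≈⟨ sum-cong-≋ (λ r → *-congˡ (proj₂ (columns-spanned j) (inject≤ r ρ≤n))) ⟩
      sum (λ r → y r * sum (λ t → x t * L r t))                     ≈⟨ sum-cong-≋ (λ r → *-distribˡ-sum (y r) (λ t → x t * L r t)) ⟩
      sum (λ r → sum (λ t → y r * (x t * L r t)))                   ≈⟨ ∑-comm (λ r t → y r * (x t * L r t)) ⟩
      sum (λ t → sum (λ r → y r * (x t * L r t)))
        ≈⟨ sum-cong-≋ (λ t → sum-cong-≋ (λ r → x∙yz≈y∙xz (y r) (x t) (L r t))) ⟩
      sum (λ t → sum (λ r → x t * (y r * L r t)))                   ≈⟨ sum-cong-≋ (λ t → *-distribˡ-sum (x t) (λ r → y r * L r t)) ⟨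
      sum (λ t → x t * sum (λ r → y r * L r t))                     ≈⟨ sum-zero _ (λ t → trans (*-congˡ (yL≈0 t)) (zeroʳ (x t))) ⟩
      0#                                                            ∎
      where
      L : Matrix ρ ρ
      L = leading F A ρ ρ≤n
      x : Fin ρ → Carrier
      x = proj₁ (columns-spanned j)

  rank-and-leading-minor : ∀ {n ρ} (A : Matrix n n) (ρ≤n : ρ ℕ.≤ n) → NonsingularMinor (topRows A ρ ρ≤n) →
                           RowsSpannedByTop A ρ ρ≤n → RowsSpannedByTop (transpose A) ρ ρ≤n →
                           Σ[ r ∈ ℕ ] IsRank F A r × IsMaxLeading F A r
  rank-and-leading-minor {n} {ρ} A ρ≤n minor rows-spanned columns-spanned =
    ρ , ((leading-rows , leading-rows , inject≤-increasing ρ≤n , inject≤-increasing ρ≤n , L≉0) , rank-bound)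
      , (leading-size ρ ≡.refl , leading-bound)
    where
    leading-rows : Fin ρ → Fin n
    leading-rows i = inject≤ i ρ≤n

    L≉0 : ¬ det F (leading F A ρ ρ≤n) ≈ 0#
    L≉0 = leading-minor-nonsingular A ρ≤n minor columns-spanned

    vanish : ∀ {s} (α β : Fin s → Fin n) → ρ ℕ.< s → det F (λ i u → A (α i) (β u)) ≈ 0#
    vanish = minors-vanish-beyond-row-span A ρ≤n rows-spanned

    rank-bound : ∀ s → HasNonsingularMinor F A s → s ℕ.≤ ρ
    rank-bound s (α , β , _ , _ , M≉0) = ℕₚ.≮⇒≥ (M≉0 ∘ vanish α β)

    leading-size : ∀ r → r ≡ ρ → ρ ≡ 0 ⊎ LeadingNonzero F A ρ
    leading-size zero    r≡ρ = inj₁ (≡.sym r≡ρ)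
    leading-size (suc _) ≡.refl = inj₂ (ℕ.s≤s ℕ.z≤n , ρ≤n , L≉0)

    leading-bound : ∀ k → LeadingNonzero F A k → k ℕ.≤ ρ
    leading-bound k (_ , k≤n , Lₖ≉0) = ℕₚ.≮⇒≥ (Lₖ≉0 ∘ vanish (λ i → inject≤ i k≤n) (λ i → inject≤ i k≤n))

prime∤! : ∀ {p} → Prime p → ∀ j → j ℕ.< p → p ∤ j !
prime∤! {p} p-prime zero    j<p p∣1 = ℕₚ.<-irrefl (≡.sym (∣1⇒≡1 p∣1)) (ℕ.nonTrivial⇒n>1 p {{prime⇒nonTrivial p-prime}})
prime∤! {p} p-prime (suc j) j<p p∣j! with euclidsLemma (suc j) (j !) p-prime p∣j!
... | inj₁ p∣1+j = ℕₚ.<-irrefl ≡.refl (ℕₚ.<-≤-trans j<p (∣⇒≤ p∣1+j))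
... | inj₂ p∣j!  = prime∤! p-prime j (ℕₚ.<-trans (ℕₚ.n<1+n j) j<p) p∣j!

prime∣choose : ∀ {p} → Prime p → ∀ k → 0 ℕ.< k → k ℕ.< p → p ∣ p C k
prime∣choose {p@(suc p-1)} p-prime k 0<k k<p
  with euclidsLemma (p C k) (k ! ℕ.* (p ∸ k) !) p-prime (≡.subst (p ∣_) (≡.sym pCk*k![p-k]!≡p!) (m∣m*n (p-1 !)))
  where
  k≤p : k ℕ.≤ p
  k≤p = ℕₚ.<⇒≤ k<p
  pCk*k![p-k]!≡p! : (p C k) ℕ.* (k ! ℕ.* (p ∸ k) !) ≡ p !
  pCk*k![p-k]!≡p! = ≡.trans (≡.cong (ℕ._* (k ! ℕ.* (p ∸ k) !)) (nCk≡n!/k![n-k]! k≤p))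
                            (m/n*n≡m {{ℕₚ._!*_!≢0 k (p ∸ k)}} (k![n∸k]!∣n! k≤p))
... | inj₁ p∣pCk = p∣pCk
... | inj₂ p∣k![p-k]! with euclidsLemma (k !) ((p ∸ k) !) p-prime p∣k![p-k]!
...   | inj₁ p∣k!     = contradiction p∣k! (prime∤! p-prime k k<p)
...   | inj₂ p∣[p-k]! = contradiction p∣[p-k]! (prime∤! p-prime (p ∸ k) (ℕₚ.∸-monoʳ-< 0<k (ℕₚ.<⇒≤ k<p)))

module Frobenius {c ℓ} (R : CommutativeRing c ℓ) where
  open CommutativeRing R hiding (zero)
  open import Algebra.Properties.Semiring.Mult semiring using (×-assoc-*; ×1-homo-*; ×-homo-1; ×-congʳ) renaming (_×_ to _·_)
  open import Algebra.Properties.Semiring.Exp semiring using (_^_; ^-assocʳ; ^-congˡ)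
  import Algebra.Properties.CommutativeSemiring.Binomial commutativeSemiring as Binomial
  open import Algebra.Properties.Semiring.Sum semiring using (sum; sum-init-last; sum-cong-≋; sum-replicate-zero)
  open import Relation.Binary.Reasoning.Setoid setoid

  multiple-vanishes : ∀ {p} → p · 1# ≈ 0# → ∀ {j} z → p ∣ j → j · z ≈ 0#
  multiple-vanishes {p} p·1≈0 z (divides d ≡.refl) = begin
    (d ℕ.* p) · z                ≈⟨ ×-congʳ (d ℕ.* p) (*-identityˡ z) ⟨
    (d ℕ.* p) · (1# * z)         ≈⟨ ×-assoc-* (d ℕ.* p) 1# z ⟨
    ((d ℕ.* p) · 1#) * z         ≈⟨ *-congʳ (×1-homo-* d p) ⟩
    ((d · 1#) * (p · 1#)) * z    ≈⟨ *-congʳ (trans (*-congˡ p·1≈0) (zeroʳ _)) ⟩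
    0# * z                       ≈⟨ zeroˡ z ⟩
    0#                           ∎

  -- In the binomial expansion of (x + y) ^ p every middle coefficient is divisible by p.
  frobenius : ∀ {p} → Prime p → p · 1# ≈ 0# → ∀ x y → (x + y) ^ p ≈ x ^ p + y ^ p
  frobenius {zero}  p-prime = contradiction p-prime ¬prime[0]
  frobenius {suc n} p-prime p·1≈0 x y = begin
    (x + y) ^ suc n                                    ≈⟨ Binomial.theorem (suc n) x y ⟩
    t zero + sum (t ∘ suc)                         ≈⟨ +-congˡ (sum-init-last (t ∘ suc)) ⟩
    t zero + (sum (λ k → t (suc (inject₁ k))) + t (suc (fromℕ n)))
                                                       ≈⟨ +-cong first (+-cong middle last) ⟩
    y ^ suc n + (0# + x ^ suc n)                       ≈⟨ trans (+-congˡ (+-identityˡ _)) (+-comm _ _) ⟩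
    x ^ suc n + y ^ suc n                              ∎
    where
    t : Fin (suc (suc n)) → Carrier
    t = Binomial.binomialTerm x y (suc n)
    first : t zero ≈ y ^ suc n
    first = trans (×-homo-1 _) (*-identityˡ _)

    middle : sum (λ k → t (suc (inject₁ k))) ≈ 0#
    middle = trans (sum-cong-≋ λ k → multiple-vanishes p·1≈0 _
                      (prime∣choose p-prime (suc (toℕ (inject₁ k))) ℕ.z<s (ℕ.s<s (inject₁ℕ< k))))
                   (sum-replicate-zero n)

    last : t (suc (fromℕ n)) ≈ x ^ suc n
    last rewrite toℕ-fromℕ n | nCn≡1 (suc n) | ℕₚ.n∸n≡0 n = trans (×-homo-1 _) (*-identityʳ _)

  frobenius-^ : ∀ {p} → Prime p → p · 1# ≈ 0# → ∀ e x y → (x + y) ^ (p ℕ.^ e) ≈ x ^ (p ℕ.^ e) + y ^ (p ℕ.^ e)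
  frobenius-^ p-prime p·1≈0 zero    x y = distribʳ 1# x y
  frobenius-^ {p} p-prime p·1≈0 (suc e) x y = begin
    (x + y) ^ (p ℕ.* p ℕ.^ e)                  ≈⟨ ^-assocʳ (x + y) p (p ℕ.^ e) ⟨
    ((x + y) ^ p) ^ (p ℕ.^ e)                  ≈⟨ ^-congˡ (p ℕ.^ e) (frobenius p-prime p·1≈0 x y) ⟩
    (x ^ p + y ^ p) ^ (p ℕ.^ e)                ≈⟨ frobenius-^ p-prime p·1≈0 e (x ^ p) (y ^ p) ⟩
    (x ^ p) ^ (p ℕ.^ e) + (y ^ p) ^ (p ℕ.^ e)  ≈⟨ +-cong (^-assocʳ x p (p ℕ.^ e)) (^-assocʳ y p (p ℕ.^ e)) ⟩
    x ^ (p ℕ.* p ℕ.^ e) + y ^ (p ℕ.* p ℕ.^ e)  ∎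

module FiniteField {c ℓ} (F : CommutativeRing c ℓ) (isField : IsField F) where
  open CommutativeRing F hiding (zero)
  open FieldProperties F isField
  open import Algebra.Properties.Semiring.Mult semiring using (×-homo-1; ×1-homo-*) renaming (_×_ to _·_)
  open import Algebra.Properties.Semiring.Exp semiring using (_^_)
  open import Algebra.Properties.Group +-group using (identityˡ-unique)
  import Algebra.Properties.CommutativeMonoid.Sum as CommutativeMonoidSum
  module ∑ = CommutativeMonoidSum +-commutativeMonoid
  module ∏ = CommutativeMonoidSum *-commutativeMonoid
  open import Relation.Binary.Reasoning.Setoid setoid

  module _ {N} (card : HasCard F N) where

    enumerate : Fin N → Carrier
    enumerate = proj₁ card

    enumerate-injective : ∀ i j → enumerate i ≈ enumerate j → i ≡ j
    enumerate-injective = proj₁ (proj₂ card)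

    index : Carrier → Fin N
    index x = proj₁ (proj₂ (proj₂ card) x)

    enumerate-index : ∀ x → enumerate (index x) ≈ x
    enumerate-index x = proj₂ (proj₂ (proj₂ card) x)

    ≈-decidable : Decidable _≈_
    ≈-decidable x y with index x Fin.≟ index y
    ... | yes i≡j = yes (trans (sym (enumerate-index x)) (trans (reflexive (≡.cong enumerate i≡j)) (enumerate-index y)))
    ... | no i≢j  = no λ x≈y → i≢j (enumerate-injective _ _ (trans (enumerate-index x) (trans x≈y (sym (enumerate-index y)))))

    permutation-of : (φ ψ : Carrier → Carrier) → (∀ {a b} → a ≈ b → φ a ≈ φ b) → (∀ {a b} → a ≈ b → ψ a ≈ ψ b) →
                     (∀ a → φ (ψ a) ≈ a) → (∀ a → ψ (φ a) ≈ a) →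
                     Σ[ π ∈ Permutation N N ] ∀ i → enumerate (π ⟨$⟩ʳ i) ≈ φ (enumerate i)
    permutation-of φ ψ φ-cong ψ-cong φψ≈id ψφ≈id =
      permutation to from to∘from from∘to , λ i → enumerate-index (φ (enumerate i))
      where
      to from : Fin N → Fin N
      to i = index (φ (enumerate i))
      from i = index (ψ (enumerate i))
      to∘from : ∀ i → to (from i) ≡ i
      to∘from i = enumerate-injective _ _ (trans (enumerate-index _) (trans (φ-cong (enumerate-index _)) (φψ≈id _)))
      from∘to : ∀ i → from (to i) ≡ i
      from∘to i = enumerate-injective _ _ (trans (enumerate-index _) (trans (ψ-cong (enumerate-index _)) (ψφ≈id _)))

    -- Translation by 1 permutes the elements, so it does not change their sum.
    characteristic : N · 1# ≈ 0#
    characteristic = identityˡ-unique (N · 1#) (∑.sum enumerate) (begin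
      N · 1# + ∑.sum enumerate                    ≈⟨ +-congʳ (∑.sum-replicate N) ⟨
      ∑.sum {N} (λ _ → 1#) + ∑.sum enumerate      ≈⟨ ∑.∑-distrib-+ (λ _ → 1#) enumerate ⟨
      ∑.sum (λ i → 1# + enumerate i)              ≈⟨ ∑.sum-cong-≋ (λ i → sym (proj₂ translation i)) ⟩
      ∑.sum (λ i → enumerate (proj₁ translation ⟨$⟩ʳ i)) ≈⟨ ∑.sum-permute enumerate (proj₁ translation) ⟨
      ∑.sum enumerate                             ∎)
      where
      translation : Σ[ π ∈ Permutation N N ] ∀ i → enumerate (π ⟨$⟩ʳ i) ≈ 1# + enumerate i
      translation = permutation-of (1# +_) (- 1# +_) +-congˡ +-congˡ
        (λ a → trans (sym (+-assoc _ _ _)) (trans (+-congʳ (-‿inverseʳ 1#)) (+-identityˡ a)))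
        (λ a → trans (sym (+-assoc _ _ _)) (trans (+-congʳ (-‿inverseˡ 1#)) (+-identityˡ a)))

  ^-nonzero : ∀ {x} k → ¬ x ≈ 0# → ¬ x ^ k ≈ 0#
  ^-nonzero zero    x≉0 = 1≉0
  ^-nonzero (suc k) x≉0 = *-nonzero x≉0 (^-nonzero k x≉0)

  ·1-^ : ∀ p k → (p ℕ.^ k) · 1# ≈ (p · 1#) ^ k
  ·1-^ p zero    = ×-homo-1 1#
  ·1-^ p (suc k) = trans (×1-homo-* p (p ℕ.^ k)) (*-congˡ (·1-^ p k))

  -- (p · 1) ^ (e (m + 1)) = q ^ (m + 1) · 1 = 0, so p · 1 = 0.
  ^q-additive : ∀ {q m} → IsPrimePower q → HasCard F (q ℕ.^ suc m) → ∀ x y → (x + y) ^ q ≈ x ^ q + y ^ q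
  ^q-additive {q} {m} (p , e@(suc e-1) , p-prime , _ , ≡.refl) card x y = frobenius-^ p-prime p·1≈0 e x y
    where
    open Frobenius F using (frobenius-^)
    k : ℕ
    k = m ℕ.+ e-1 ℕ.* suc m
    p·1≈0 : p · 1# ≈ 0#
    p·1≈0 with ≈-decidable card (p · 1#) 0#
    ... | yes p·1≈0 = p·1≈0
    ... | no p·1≉0  = contradiction (begin
      (p · 1#) ^ suc k              ≈⟨ ·1-^ p (suc k) ⟨
      (p ℕ.^ suc k) · 1#            ≡⟨ ≡.cong (_· 1#) (ℕₚ.^-*-assoc p e (suc m)) ⟨
      ((p ℕ.^ e) ℕ.^ suc m) · 1#    ≈⟨ characteristic card ⟩
      0#                            ∎) (^-nonzero (suc k) p·1≉0)

  product-nonzero : ∀ {n} (f : Fin n → Carrier) → (∀ i → ¬ f i ≈ 0#) → ¬ ∏.sum f ≈ 0#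
  product-nonzero {zero}  f f≉0 = 1≉0
  product-nonzero {suc n} f f≉0 = *-nonzero (f≉0 zero) (product-nonzero (f ∘ suc) (f≉0 ∘ suc))

  module _ {n} (card : HasCard F (suc n)) where

    nonzero : Fin n → Carrier
    nonzero j = enumerate card (punchIn (index card 0#) j)

    nonzero≉0 : ∀ j → ¬ nonzero j ≈ 0#
    nonzero≉0 j ≈0 = punchInᵢ≢i _ j (enumerate-injective card _ _ (trans ≈0 (sym (enumerate-index card 0#))))

    -- Multiplication by x fixes 0, so the permutation it induces restricts to the nonzero elements.
    scaling-permutation : ∀ x → ¬ x ≈ 0# → Σ[ π ∈ Permutation n n ] ∀ j → nonzero (π ⟨$⟩ʳ j) ≈ x * nonzero j
    scaling-permutation x x≉0 = Perm.remove i₀ π , λ j → begin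
      enumerate card (punchIn i₀ (Perm.remove i₀ π ⟨$⟩ʳ j))
        ≡⟨ ≡.cong (λ i → enumerate card (punchIn i (Perm.remove i₀ π ⟨$⟩ʳ j))) π-fixes-i₀ ⟨
      enumerate card (punchIn (π ⟨$⟩ʳ i₀) (Perm.remove i₀ π ⟨$⟩ʳ j))  ≡⟨ ≡.cong (enumerate card) (Perm.punchIn-permute π i₀ j) ⟨
      enumerate card (π ⟨$⟩ʳ punchIn i₀ j)                             ≈⟨ proj₂ scaling (punchIn i₀ j) ⟩
      x * nonzero j                                                    ∎
      where
      i₀ : Fin (suc n)
      i₀ = index card 0#
      x⁻¹ : Carrier
      x⁻¹ = proj₁ (inverse x x≉0)
      xx⁻¹≈1 : x * x⁻¹ ≈ 1#
      xx⁻¹≈1 = proj₂ (inverse x x≉0)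
      scaling : Σ[ π ∈ Permutation (suc n) (suc n) ] ∀ i → enumerate card (π ⟨$⟩ʳ i) ≈ x * enumerate card i
      scaling = permutation-of card (x *_) (x⁻¹ *_) *-congˡ *-congˡ
        (λ a → trans (sym (*-assoc _ _ _)) (trans (*-congʳ xx⁻¹≈1) (*-identityˡ a)))
        (λ a → trans (sym (*-assoc _ _ _)) (trans (*-congʳ (trans (*-comm _ _) xx⁻¹≈1)) (*-identityˡ a)))
      π : Permutation (suc n) (suc n)
      π = proj₁ scaling

      π-fixes-i₀ : π ⟨$⟩ʳ i₀ ≡ i₀
      π-fixes-i₀ = enumerate-injective card _ _ (begin
        enumerate card (π ⟨$⟩ʳ i₀)   ≈⟨ proj₂ scaling i₀ ⟩
        x * enumerate card i₀        ≈⟨ *-congˡ (enumerate-index card 0#) ⟩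
        x * 0#                       ≈⟨ zeroʳ x ⟩
        0#                           ≈⟨ enumerate-index card 0# ⟨
        enumerate card i₀            ∎)

  -- The product P of the nonzero elements satisfies x ^ (N - 1) * P ≈ P.
  fermat : ∀ {N} → HasCard F N → ∀ x → x ^ N ≈ x
  fermat {zero}  card x = contradiction (index card 0#) λ ()
  fermat {suc n} card x with ≈-decidable card x 0#
  ... | yes x≈0 = trans (*-congʳ x≈0) (trans (zeroˡ _) (sym x≈0))
  ... | no x≉0  = trans (*-congˡ xⁿ≈1) (*-identityʳ x)
    where
    π : Permutation n n
    π = proj₁ (scaling-permutation card x x≉0)
    P : Carrier
    P = ∏.sum (nonzero card)

    xⁿ≈1 : x ^ n ≈ 1#
    xⁿ≈1 = *-cancelʳ (product-nonzero (nonzero card) (nonzero≉0 card)) (begin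
      x ^ n * P                                ≈⟨ *-congʳ (∏.sum-replicate n) ⟨
      ∏.sum {n} (λ _ → x) * P                  ≈⟨ ∏.∑-distrib-+ (λ _ → x) (nonzero card) ⟨
      ∏.sum (λ j → x * nonzero card j)         ≈⟨ ∏.sum-cong-≋ (proj₂ (scaling-permutation card x x≉0)) ⟨
      ∏.sum (λ j → nonzero card (π ⟨$⟩ʳ j))    ≈⟨ ∏.sum-permute (nonzero card) π ⟨
      P                                        ≈⟨ *-identityˡ P ⟨
      1# * P                                   ∎)

module TwistedCirculant {c ℓ} (F : CommutativeRing c ℓ) (isField : IsField F)
                        (_≈?_ : Decidable (CommutativeRing._≈_ F))
                        (σ : CommutativeRing.Carrier F → CommutativeRing.Carrier F)
                        (σ-cong : ∀ {x y} → CommutativeRing._≈_ F x y → CommutativeRing._≈_ F (σ x) (σ y))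
                        (σ-+ : ∀ x y → CommutativeRing._≈_ F (σ (CommutativeRing._+_ F x y)) (CommutativeRing._+_ F (σ x) (σ y)))
                        (σ-* : ∀ x y → CommutativeRing._≈_ F (σ (CommutativeRing._*_ F x y)) (CommutativeRing._*_ F (σ x) (σ y)))
                        where
  open CommutativeRing F hiding (zero)
  open Determinant F
  open FieldProperties F isField
  open FieldLinearAlgebra F isField _≈?_
  open import Relation.Binary.Reasoning.Setoid setoid

  σ-0 : σ 0# ≈ 0#
  σ-0 = identityˡ-unique (σ 0#) (σ 0#) (trans (sym (σ-+ 0# 0#)) (σ-cong (+-identityˡ 0#)))
    where open import Algebra.Properties.Group +-group using (identityˡ-unique)

  σ-sum : ∀ {k} (f : Fin k → Carrier) → σ (sum f) ≈ sum (σ ∘ f)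
  σ-sum {zero}  f = σ-0
  σ-sum {suc k} f = trans (σ-+ _ _) (+-congˡ (σ-sum (f ∘ suc)))

  module _ {m} (A : Matrix (suc m) (suc m)) (twisted : IsTwistedCirculant σ A) where

    -- σ and the cyclic shift carry an expression of row i through rows 0 … t - 1 to one of
    -- row i + 1 through rows 1 … t, which all lie in the span.
    twisted-closure : ∀ {t} (t<n : t ℕ.< suc m) → InTopRowSpan A t (ℕₚ.<⇒≤ t<n) (A (fromℕ< t<n)) →
                      ∀ i → InTopRowSpan A t (ℕₚ.<⇒≤ t<n) (A i)
    twisted-closure {t} t<n rowₜ∈span = <-weakInduction (InTopRowSpan A t t≤n ∘ A) (row-in-span zero z≤n) step
      where
      t≤n : t ℕ.≤ suc m
      t≤n = ℕₚ.<⇒≤ t<n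

      row-in-span : ∀ i → toℕ i ℕ.≤ t → InTopRowSpan A t t≤n (A i)
      row-in-span i i≤t with ℕₚ.m≤n⇒m<n∨m≡n i≤t
      ... | inj₁ i<t = top-row-in-span A t≤n i i<t
      ... | inj₂ i≡t = ≡.subst (InTopRowSpan A t t≤n ∘ A)
                         (Fin.toℕ-injective (≡.trans (Fin.toℕ-fromℕ< t<n) (≡.sym i≡t))) rowₜ∈span

      next<n : ∀ (s : Fin t) → suc (toℕ s) ℕ.< suc m
      next<n s = ℕₚ.<-≤-trans (s≤s (Fin.toℕ<n s)) t<n
      next : Fin t → Fin (suc m)
      next s = fromℕ< (next<n s)
      toℕ-next : ∀ s → toℕ (next s) ≡ suc (toℕ (inject≤ s t≤n))
      toℕ-next s = ≡.trans (Fin.toℕ-fromℕ< (next<n s)) (≡.cong suc (≡.sym (Fin.toℕ-inject≤ s t≤n)))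

      step : ∀ i → InTopRowSpan A t t≤n (A (inject₁ i)) → InTopRowSpan A t t≤n (A (suc i))
      step i (y , Aᵢ≈yT) = proj₁ combination , λ j → trans (shifted j) (proj₂ combination j)
        where
        combination : InTopRowSpan A t t≤n (λ j → sum (λ s → σ (y s) * A (next s) j))
        combination = span-combination A t≤n (σ ∘ y) (A ∘ next)
          (λ s → row-in-span (next s) (≡.subst (ℕ._≤ t) (≡.sym (Fin.toℕ-fromℕ< (next<n s))) (Fin.toℕ<n s)))
        shifted : ∀ j → A (suc i) j ≈ sum (λ s → σ (y s) * A (next s) j)
        shifted j = begin
          A (suc i) j                                         ≈⟨ twisted (inject₁ i) (suc i) (≡.cong suc (≡.sym (Fin.toℕ-inject₁ i))) j ⟩
          σ (A (inject₁ i) (cyclicPred j))                    ≈⟨ σ-cong (Aᵢ≈yT (cyclicPred j)) ⟩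
          σ (sum (λ s → y s * topRows A t t≤n s (cyclicPred j))) ≈⟨ σ-sum (λ s → y s * topRows A t t≤n s (cyclicPred j)) ⟩
          sum (λ s → σ (y s * topRows A t t≤n s (cyclicPred j))) ≈⟨ sum-cong-≋ (λ s → trans (σ-* _ _)
                                                                   (*-congˡ (sym (twisted (inject≤ s t≤n) (next s) (toℕ-next s) j)))) ⟩
          sum (λ s → σ (y s) * A (next s) j)                   ∎

    -- Row t depends on the rows above it: its coefficient in the dependency cannot vanish,
    -- since the rows above carry a nonsingular minor.
    next-row-in-span : ∀ {t} (t<n : t ℕ.< suc m) → NonsingularMinor (topRows A t (ℕₚ.<⇒≤ t<n)) →
                       RowDependency (topRows A (suc t) t<n) → InTopRowSpan A t (ℕₚ.<⇒≤ t<n) (A (fromℕ< t<n))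
    next-row-in-span {t} t<n (β , _ , minor≉0) (y , (r₀ , yᵣ₀≉0) , yB≈0) = by-last-coefficient (y (fromℕ t) ≈? 0#)
      where
      t≤n : t ℕ.≤ suc m
      t≤n = ℕₚ.<⇒≤ t<n
      B : Matrix (suc t) (suc m)
      B = topRows A (suc t) t<n

      earlier≡ : ∀ r → inject≤ (punchIn (fromℕ t) r) t<n ≡ inject≤ r t≤n
      earlier≡ r = Fin.toℕ-injective (≡.trans (Fin.toℕ-inject≤ _ t<n) (≡.trans (≡.cong toℕ (punchIn-fromℕ r))
                                     (≡.trans (toℕ-inject₁ r) (≡.sym (Fin.toℕ-inject≤ r t≤n)))))

      last≡ : inject≤ (fromℕ t) t<n ≡ fromℕ< t<n
      last≡ = Fin.toℕ-injective (≡.trans (Fin.toℕ-inject≤ (fromℕ t) t<n)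
                                 (≡.trans (toℕ-fromℕ t) (≡.sym (Fin.toℕ-fromℕ< t<n))))

      by-last-coefficient : Dec (y (fromℕ t) ≈ 0#) → InTopRowSpan A t t≤n (A (fromℕ< t<n))
      by-last-coefficient (yes yₜ≈0) = contradiction (punchIn-cases (fromℕ t) yₜ≈0 earlier-vanish r₀) yᵣ₀≉0
        where
        earlier-vanish : ∀ r → y (punchIn (fromℕ t) r) ≈ 0#
        earlier-vanish = nonsingular⇒left-null-trivial (λ r u → B (punchIn (fromℕ t) r) (β u))
          (minor≉0 ∘ trans (det-cong (λ r u → reflexive (≡.cong (λ i → A i (β u)) (≡.sym (earlier≡ r))))))
          (y ∘ punchIn (fromℕ t)) (λ u → annihilates-punchIn B y (fromℕ t) yₜ≈0 yB≈0 (β u))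
      by-last-coefficient (no yₜ≉0) = z , λ j → begin
        A (fromℕ< t<n) j                                 ≡⟨ ≡.cong (λ i → A i j) last≡ ⟨
        B (fromℕ t) j                                    ≈⟨ proj₂ (dependent-row-in-span B y (fromℕ t) yₜ≉0 yB≈0) j ⟩
        sum (λ r → z r * B (punchIn (fromℕ t) r) j)
          ≈⟨ sum-cong-≋ (λ r → *-congˡ (reflexive (≡.cong (λ i → A i j) (earlier≡ r)))) ⟩
        sum (λ r → z r * topRows A t t≤n r j)            ∎
        where
        z : Fin t → Carrier
        z = proj₁ (dependent-row-in-span B y (fromℕ t) yₜ≉0 yB≈0)

    TopRowsSpanning : Set (c ⊔ ℓ)
    TopRowsSpanning = Σ[ ρ ∈ ℕ ] Σ[ ρ≤n ∈ ρ ℕ.≤ suc m ]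
                        NonsingularMinor (topRows A ρ ρ≤n) × (∀ i → InTopRowSpan A ρ ρ≤n (A i))

    -- Add rows one at a time while the top rows keep a nonsingular minor.
    top-rows-spanning : TopRowsSpanning
    top-rows-spanning = grow (suc m) 0 z≤n (ℕₚ.+-identityʳ (suc m)) ((λ ()) , (λ ()) , 1≉0)
      where
      grow : ∀ d t (t≤n : t ℕ.≤ suc m) → d ℕ.+ t ≡ suc m → NonsingularMinor (topRows A t t≤n) → TopRowsSpanning
      grow zero    t t≤n t≡n minor =
        t , t≤n , minor , λ i → top-row-in-span A t≤n i (≡.subst (toℕ i ℕ.<_) (≡.sym t≡n) (Fin.toℕ<n i))
      grow (suc d) t t≤n d+t≡n minor = extend (nonsingular-minor⊎row-dependency (suc m) (topRows A (suc t) t<n))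
        where
        t<n : t ℕ.< suc m
        t<n = ≡.subst (t ℕ.<_) d+t≡n (ℕₚ.m<n+m t ℕ.z<s)
        extend : NonsingularMinor (topRows A (suc t) t<n) ⊎ RowDependency (topRows A (suc t) t<n) → TopRowsSpanning
        extend (inj₁ minor′)    = grow d (suc t) t<n (≡.trans (ℕₚ.+-suc d t) d+t≡n) minor′
        extend (inj₂ dependent) = t , t≤n , minor , twisted-closure t<n (next-row-in-span t<n minor dependent)

  -- The two counts agree: each bounds the size of the other's nonsingular minor.
  rank-of-twisted-circulant : ∀ {m} (A : Matrix (suc m) (suc m)) →
                              IsTwistedCirculant σ A → IsTwistedCirculant σ (transpose A) →
                              Σ[ r ∈ ℕ ] IsRank F A r × IsMaxLeading F A r
  rank-of-twisted-circulant {m} A rows-twisted columns-twisted =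
    combine (top-rows-spanning A rows-twisted) (top-rows-spanning (transpose A) columns-twisted)
    where
    combine : TopRowsSpanning A rows-twisted → TopRowsSpanning (transpose A) columns-twisted →
              Σ[ r ∈ ℕ ] IsRank F A r × IsMaxLeading F A r
    combine (ρ , ρ≤n , row-minor@(β , _ , row-minor≉0) , rows-spanned) (γ , γ≤n , (α , _ , column-minor≉0) , columns-spanned)
      = aligned γ γ≤n columns-spanned (ℕₚ.≤-antisym ρ≤γ γ≤ρ)
      where
      aligned : ∀ γ (γ≤n : γ ℕ.≤ suc m) → RowsSpannedByTop (transpose A) γ γ≤n → ρ ≡ γ →
                Σ[ r ∈ ℕ ] IsRank F A r × IsMaxLeading F A r
      aligned γ γ≤n columns-spanned ≡.refl = rank-and-leading-minor A ρ≤n row-minor rows-spanned columns-spanned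

      ρ≤γ : ρ ℕ.≤ γ
      ρ≤γ = ℕₚ.≮⇒≥ (row-minor≉0 ∘ minors-vanish-beyond-column-span A γ≤n columns-spanned (λ i → inject≤ i ρ≤n) β)
      γ≤ρ : γ ℕ.≤ ρ
      γ≤ρ = ℕₚ.≮⇒≥ (column-minor≉0 ∘
              minors-vanish-beyond-column-span (transpose A) ρ≤n rows-spanned (λ i → inject≤ i γ≤n) α)

mod-cong : ∀ x y {n} .{{_ : ℕ.NonZero n}} → x % n ≡ y % n → x mod n ≡ y mod n
mod-cong x y x%n≡y%n = Fin.fromℕ<-cong _ _ x%n≡y%n _ _

dicksonIndex : ∀ {m} → Fin (suc m) → Fin (suc m) → Fin (suc m)
dicksonIndex {m} i j = (suc m ℕ.+ toℕ j ∸ toℕ i) mod suc m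

module _ {m} {i i′ : Fin (suc m)} (i′≡1+i : toℕ i′ ≡ suc (toℕ i)) where
  open ≡.≡-Reasoning

  dicksonIndex-diagonal : ∀ {j j′ : Fin (suc m)} → toℕ j′ ≡ suc (toℕ j) → dicksonIndex i′ j′ ≡ dicksonIndex i j
  dicksonIndex-diagonal {j} {j′} j′≡1+j = ≡.cong (_mod suc m) (begin
    suc m ℕ.+ toℕ j′ ∸ toℕ i′               ≡⟨ ≡.cong₂ (λ x y → suc m ℕ.+ x ∸ y) j′≡1+j i′≡1+i ⟩
    suc m ℕ.+ suc (toℕ j) ∸ suc (toℕ i)     ≡⟨ ≡.cong (_∸ suc (toℕ i)) (ℕₚ.+-suc (suc m) (toℕ j)) ⟩
    suc m ℕ.+ toℕ j ∸ toℕ i                 ∎)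

  dicksonIndex-wrap-row : dicksonIndex i′ zero ≡ dicksonIndex i (fromℕ m)
  dicksonIndex-wrap-row = mod-cong (suc m ℕ.+ 0 ∸ toℕ i′) (suc m ℕ.+ toℕ (fromℕ m) ∸ toℕ i) (begin
    (suc m ℕ.+ 0 ∸ toℕ i′) % suc m              ≡⟨ ≡.cong (λ x → (suc m ℕ.+ 0 ∸ x) % suc m) i′≡1+i ⟩
    (m ℕ.+ 0 ∸ toℕ i) % suc m                   ≡⟨ ≡.cong (λ x → (x ∸ toℕ i) % suc m) (ℕₚ.+-identityʳ m) ⟩
    (m ∸ toℕ i) % suc m                         ≡⟨ [m+n]%n≡m%n (m ∸ toℕ i) (suc m) ⟨
    (m ∸ toℕ i ℕ.+ suc m) % suc m               ≡⟨ ≡.cong (_% suc m) (ℕₚ.+-comm (m ∸ toℕ i) (suc m)) ⟩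
    (suc m ℕ.+ (m ∸ toℕ i)) % suc m             ≡⟨ ≡.cong (_% suc m) (ℕₚ.+-∸-assoc (suc m) i≤m) ⟨
    (suc m ℕ.+ m ∸ toℕ i) % suc m               ≡⟨ ≡.cong (λ x → (suc m ℕ.+ x ∸ toℕ i) % suc m) (Fin.toℕ-fromℕ m) ⟨
    (suc m ℕ.+ toℕ (fromℕ m) ∸ toℕ i) % suc m   ∎)
    where
    i≤m : toℕ i ℕ.≤ m
    i≤m = ℕₚ.<⇒≤ (ℕₚ.≤-pred (≡.subst (ℕ._< suc m) i′≡1+i (Fin.toℕ<n i′)))

  dicksonIndex-wrap-column : dicksonIndex zero i′ ≡ dicksonIndex (fromℕ m) i
  dicksonIndex-wrap-column = mod-cong (suc m ℕ.+ toℕ i′ ∸ 0) (suc m ℕ.+ toℕ i ∸ toℕ (fromℕ m)) (begin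
    (suc m ℕ.+ toℕ i′ ∸ 0) % suc m              ≡⟨ ≡.cong (λ x → (suc m ℕ.+ x) % suc m) i′≡1+i ⟩
    (suc m ℕ.+ suc (toℕ i)) % suc m             ≡⟨ ≡.cong (_% suc m) (ℕₚ.+-comm (suc m) (suc (toℕ i))) ⟩
    (suc (toℕ i) ℕ.+ suc m) % suc m             ≡⟨ [m+n]%n≡m%n (suc (toℕ i)) (suc m) ⟩
    suc (toℕ i) % suc m                         ≡⟨ ≡.cong (_% suc m) (ℕₚ.m+n∸m≡n m (suc (toℕ i))) ⟨
    (m ℕ.+ suc (toℕ i) ∸ m) % suc m             ≡⟨ ≡.cong (λ x → (x ∸ m) % suc m) (ℕₚ.+-suc m (toℕ i)) ⟩
    (suc m ℕ.+ toℕ i ∸ m) % suc m               ≡⟨ ≡.cong (λ x → (suc m ℕ.+ toℕ i ∸ x) % suc m) (Fin.toℕ-fromℕ m) ⟨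
    (suc m ℕ.+ toℕ i ∸ toℕ (fromℕ m)) % suc m   ∎)

module DicksonMatrix {c ℓ} (F : CommutativeRing c ℓ) (q m : ℕ) where
  open CommutativeRing F hiding (zero)
  open Determinant F using (Matrix; transpose; IsTwistedCirculant)
  open import Algebra.Properties.Semiring.Exp semiring using (_^_; ^-assocʳ; ^-congˡ)
  open import Relation.Binary.Reasoning.Setoid setoid

  pow≡^ : ∀ x k → pow F x k ≡ x ^ k
  pow≡^ x zero    = ≡.refl
  pow≡^ x (suc k) = ≡.cong (x *_) (pow≡^ x k)

  ^-q-step : ∀ x i → x ^ (q ℕ.^ suc i) ≈ (x ^ (q ℕ.^ i)) ^ q
  ^-q-step x i = trans (reflexive (≡.cong (x ^_) (ℕₚ.*-comm q (q ℕ.^ i)))) (sym (^-assocʳ x (q ℕ.^ i) q))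

  module _ {A : Matrix (suc m) (suc m)} (dickson : IsDickson F q m A) where
    private
      a : Fin (suc m) → Carrier
      a = proj₁ dickson

    entry : ∀ i j → A i j ≈ a (dicksonIndex i j) ^ (q ℕ.^ toℕ i)
    entry i j = trans (proj₂ dickson i j) (reflexive (pow≡^ (a (dicksonIndex i j)) (q ℕ.^ toℕ i)))

    next-entry : ∀ {i i′ j j′} → toℕ i′ ≡ suc (toℕ i) → dicksonIndex i′ j′ ≡ dicksonIndex i j → A i′ j′ ≈ A i j ^ q
    next-entry {i} {i′} {j} {j′} i′≡1+i same-index = begin
      A i′ j′                                        ≈⟨ entry i′ j′ ⟩
      a (dicksonIndex i′ j′) ^ (q ℕ.^ toℕ i′)        ≡⟨ ≡.cong₂ (λ k e → a k ^ (q ℕ.^ e)) same-index i′≡1+i ⟩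
      a (dicksonIndex i j) ^ (q ℕ.^ suc (toℕ i))     ≈⟨ ^-q-step _ (toℕ i) ⟩
      (a (dicksonIndex i j) ^ (q ℕ.^ toℕ i)) ^ q     ≈⟨ ^-congˡ q (entry i j) ⟨
      A i j ^ q                                      ∎

    rows-twisted : IsTwistedCirculant (_^ q) A
    rows-twisted i i′ i′≡1+i zero    = next-entry i′≡1+i (dicksonIndex-wrap-row i′≡1+i)
    rows-twisted i i′ i′≡1+i (suc j) = next-entry i′≡1+i (dicksonIndex-diagonal i′≡1+i (≡.cong suc (≡.sym (Fin.toℕ-inject₁ j))))

    -- Going round the corner uses x ^ (q ^ n) ≈ x.
    columns-twisted : (∀ x → x ^ (q ℕ.^ suc m) ≈ x) → IsTwistedCirculant (_^ q) (transpose A)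
    columns-twisted fermat i i′ i′≡1+i zero = begin
      A zero i′                                              ≈⟨ entry zero i′ ⟩
      a (dicksonIndex zero i′) ^ 1                           ≈⟨ *-identityʳ _ ⟩
      a (dicksonIndex zero i′)                               ≡⟨ ≡.cong a (dicksonIndex-wrap-column i′≡1+i) ⟩
      a (dicksonIndex (fromℕ m) i)                           ≈⟨ fermat _ ⟨
      a (dicksonIndex (fromℕ m) i) ^ (q ℕ.^ suc m)
        ≡⟨ ≡.cong (λ e → a (dicksonIndex (fromℕ m) i) ^ (q ℕ.^ suc e)) (Fin.toℕ-fromℕ m) ⟨
      a (dicksonIndex (fromℕ m) i) ^ (q ℕ.^ suc (toℕ (fromℕ m))) ≈⟨ ^-q-step _ (toℕ (fromℕ m)) ⟩
      (a (dicksonIndex (fromℕ m) i) ^ (q ℕ.^ toℕ (fromℕ m))) ^ q ≈⟨ ^-congˡ q (entry (fromℕ m) i) ⟨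
      A (fromℕ m) i ^ q                                      ∎
    columns-twisted fermat i i′ i′≡1+i (suc j) =
      next-entry (≡.cong suc (≡.sym (Fin.toℕ-inject₁ j))) (dicksonIndex-diagonal (≡.cong suc (≡.sym (Fin.toℕ-inject₁ j))) i′≡1+i)

-- Imported only here: above, _^_ is the power in a ring.
open import Data.Nat.Base using (_^_)

mainTheorem9 : ∀ {c ℓ : Level} (q m : ℕ) → IsPrimePower q →
    (F : CommutativeRing c ℓ) → IsFiniteFieldOfOrder F (q ^ suc m) →
    (A : Fin (suc m) → Fin (suc m) → CommutativeRing.Carrier F) →
    IsDickson F q m A →
    Σ ℕ λ r → IsRank F A r × IsMaxLeading F A r
mainTheorem9 q m q-prime-power F (isField , card) A dickson =
  rank-of-twisted-circulant A (rows-twisted dickson) (columns-twisted dickson (fermat card))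
  where
  open CommutativeRing F using (_≈_; _*_)
  open import Algebra.Properties.Semiring.Exp (CommutativeRing.semiring F) using () renaming (_^_ to _^ᶠ_; ^-congˡ to ^ᶠ-congˡ)
  open import Algebra.Properties.CommutativeSemiring.Exp (CommutativeRing.commutativeSemiring F) using () renaming (^-distrib-* to ^ᶠ-distrib-*)
  open FiniteField F isField using (fermat; ^q-additive; ≈-decidable)
  open DicksonMatrix F q m using (rows-twisted; columns-twisted)

  ^q-multiplicative : ∀ x y → (x * y) ^ᶠ q ≈ x ^ᶠ q * y ^ᶠ q
  ^q-multiplicative x y = ^ᶠ-distrib-* x y q

  open TwistedCirculant F isField (≈-decidable card) (_^ᶠ q) (^ᶠ-congˡ q) (^q-additive {m = m} q-prime-power card) ^q-multiplicative
    using (rank-of-twisted-circulant)
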